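{- Let $p\ge3$. Let $R,S$ be the unique formal power series in $z$ with constant term $0$ satisfying $R=z+u\Phi_1(R,S)$ and $S=u\Phi_2(R,S)$, and let $\tilde S$ be the unique formal power series in $z$ with $\tilde S(0)=0$ and $\tilde S=u\Phi_2(z,\tilde S)$, where $$\Phi_1(x,y)=\sum_{i\ge1}\sum_{j\ge0}t_{2i+j}\binom{2i+j-1}{i-1,i,j}x^iy^j,\qquad \Phi_2(x,y)=\sum_{i\ge0}\sum_{j\ge0}t_{2i+j+1}\binom{2i+j}{i,i,j}x^iy^j.$$ Then $R$, $S$ and $\tilde S$ are respectively the generating functions of enriched R-trees, enriched S-trees and enriched $\tilde S$-trees, where each tree is weighted by $z^{\#\text{leaves}}u^{\#\text{components of the forest}}$.
   Context: Trees are plane trees rooted at a half-edge, drawn hanging from the root; a vertex of degree $d$ has $d-1$ children. A subtree consists of a vertex $v$ and all its descendants, rooted at the half-edge just above $v$. A $p$-valent blossoming tree is a plane tree rooted at a half-edge whose childless extremities are of two kinds, leaves (charge $+1$) and buds (charge $-1$), all other vertices having degree $p$; the edges carrying leaves and buds, and the root half-edge, are half-edges (not edges), and the root half-edge carries neither a leaf nor a bud; leaves and buds are not vertices, so a spanning forest (a set of edges, without cycles, spanning all vertices) contains none of these half-edges. The charge of a tree or subtree is its number of leaves minus its number of buds. A pair $(T,F)$, $T$ a $p$-valent blossoming tree and $F$ a spanning forest of $T$, is an enriched R-tree (resp. S-tree) if $T$ has charge $1$ (resp. $0$) and every subtree rooted at an edge not in $F$ has charge $0$ or $1$; in addition, a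 single root half-edge carrying a leaf (no vertex, no forest) is an enriched R-tree. $(T,F)$ is an enriched $\tilde S$-tree if each component of $F$ is incident to as many leaves as buds. $\binom{a+b+c}{a,b,c}=(a+b+c)!/(a!b!c!)$. The numbers $t_k$: if $k=(p-2)\ell+2$ with $\ell\ge1$, $t_k=\frac{((p-1)\ell)!}{\ell!((p-2)\ell+1)!}$; otherwise $t_k=0$. -}

module Defs where

open import Data.Nat using (ℕ; zero; suc; _+_; _*_; _∸_; _≡ᵇ_; _!; _/_; _≤_)
open import Data.Nat.Properties using (_!≢0; m*n≢0)
open import Data.Bool using (Bool; true; false; if_then_else_; _∧_)
open import Data.Integer using (ℤ; +_; _-_)
open import Data.Vec using (Vec; []; _∷_)
open import Data.Product using (Σ; _×_)
open import Data.Sum using (_⊎_)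
open import Data.Unit using (⊤)
open import Relation.Binary.PropositionalEquality using (_≡_)

sumTo : ℕ → (ℕ → ℕ) → ℕ
sumTo zero    f = f 0
sumTo (suc n) f = sumTo n f + f (suc n)

multinom : ℕ → ℕ → ℕ → ℕ
multinom a b c = ((a + b + c) !) / ((a ! * b !) * c !)
  where instance _ = m*n≢0 (a ! * b !) (c !) {{m*n≢0 (a !) (b !) {{a !≢0}} {{b !≢0}}}} {{c !≢0}}

fuss : ℕ → ℕ → ℕ
fuss p ℓ = (((p ∸ 1) * ℓ) !) / (ℓ ! * ((p ∸ 2) * ℓ + 1) !)
  where instance _ = m*n≢0 (ℓ !) (((p ∸ 2) * ℓ + 1) !) {{ℓ !≢0}} {{((p ∸ 2) * ℓ + 1) !≢0}}

-- t_k = fuss p ℓ if k = (p-2)ℓ+2 with ℓ ≥ 1, and 0 otherwise.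
-- For p ≥ 3 such an ℓ is unique and satisfies ℓ ≤ k, so the sum below
-- has at most one nonzero term.
tcoef : ℕ → ℕ → ℕ
tcoef p k = sumTo k (λ ℓ → match ℓ)
  where
  match : ℕ → ℕ
  match zero    = 0
  match (suc l) = if k ≡ᵇ ((p ∸ 2) * suc l + 2) then fuss p (suc l) else 0

-- Formal power series in z and u with ℕ coefficients:
-- F n k = coefficient of z^n u^k.

Series : Set
Series = ℕ → ℕ → ℕ

zₛ : Series
zₛ 1 0 = 1
zₛ _ _ = 0

oneₛ : Series
oneₛ 0 0 = 1
oneₛ _ _ = 0

_+ₛ_ : Series → Series → Series
(f +ₛ g) n k = f n k + g n k

_*ₛ_ : Series → Series → Series
(f *ₛ g) n k = sumTo n (λ a → sumTo k (λ b → f a b * g (n ∸ a) (k ∸ b)))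

_^ₛ_ : Series → ℕ → Series
f ^ₛ zero  = oneₛ
f ^ₛ suc i = f *ₛ (f ^ₛ i)

uₛ : Series → Series
uₛ f n zero    = 0
uₛ f n (suc k) = f n k

-- Valid (exact) substitution when X and Y have zero constant term in z:
-- then X^i Y^j has z-order ≥ i+j, so only i,j ≤ n contribute to [z^n].
Φ₁ : ℕ → Series → Series → Series
Φ₁ p X Y n k = sumTo n (λ i → sumTo n (λ j → term i j))
  where
  term : ℕ → ℕ → ℕ
  term zero    j = 0
  term (suc i) j = tcoef p (2 * suc i + j) * multinom i (suc i) j
                   * ((X ^ₛ suc i) *ₛ (Y ^ₛ j)) n k

Φ₂ : ℕ → Series → Series → Series
Φ₂ p X Y n k = sumTo n (λ i → sumTo n (λ j →
  tcoef p (2 * i + j + 1) * multinom i i j * ((X ^ₛ i) *ₛ (Y ^ₛ j)) n k))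

-- p-valent blossoming trees with a spanning forest.
-- A vertex has p-1 ordered children slots; each is a leaf, a bud, or an
-- edge to a child vertex, the Bool recording whether that edge is in F.
-- (Every subset of edges of a tree is a spanning forest.)

data Child (p : ℕ) : Set
data Node (p : ℕ) : Set

data Node p where
  node : Vec (Child p) (p ∸ 1) → Node p

data Child p where
  leaf : Child p
  bud  : Child p
  edge : Bool → Node p → Child p

mutual
  leaves : ∀ {p} → Node p → ℕ
  leaves (node cs) = leavesV cs

  leavesV : ∀ {p m} → Vec (Child p) m → ℕ
  leavesV [] = 0
  leavesV (leaf ∷ cs)     = suc (leavesV cs)
  leavesV (bud ∷ cs)      = leavesV cs
  leavesV (edge _ t ∷ cs) = leaves t + leavesV cs

mutual
  buds : ∀ {p} → Node p → ℕ
  buds (node cs) = budsV cs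

  budsV : ∀ {p m} → Vec (Child p) m → ℕ
  budsV [] = 0
  budsV (leaf ∷ cs)     = budsV cs
  budsV (bud ∷ cs)      = suc (budsV cs)
  budsV (edge _ t ∷ cs) = buds t + budsV cs

charge : ∀ {p} → Node p → ℤ
charge t = + leaves t - + buds t

mutual
  nonF : ∀ {p} → Node p → ℕ
  nonF (node cs) = nonFV cs

  nonFV : ∀ {p m} → Vec (Child p) m → ℕ
  nonFV [] = 0
  nonFV (leaf ∷ cs)         = nonFV cs
  nonFV (bud ∷ cs)          = nonFV cs
  nonFV (edge true t ∷ cs)  = nonF t + nonFV cs
  nonFV (edge false t ∷ cs) = suc (nonF t + nonFV cs)

-- number of components of F: each component has a unique topmost vertex,
-- which is either the root vertex or the lower end of an edge not in F.
components : ∀ {p} → Node p → ℕ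
components t = suc (nonF t)

mutual
  ForallNonF : ∀ {p} → (Node p → Set) → Node p → Set
  ForallNonF P (node cs) = ForallNonFV P cs

  ForallNonFV : ∀ {p m} → (Node p → Set) → Vec (Child p) m → Set
  ForallNonFV P [] = ⊤
  ForallNonFV P (leaf ∷ cs)         = ForallNonFV P cs
  ForallNonFV P (bud ∷ cs)          = ForallNonFV P cs
  ForallNonFV P (edge true t ∷ cs)  = ForallNonF P t × ForallNonFV P cs
  ForallNonFV P (edge false t ∷ cs) = (P t × ForallNonF P t) × ForallNonFV P cs

mutual
  compLeaves : ∀ {p} → Node p → ℕ
  compLeaves (node cs) = compLeavesV cs

  compLeavesV : ∀ {p m} → Vec (Child p) m → ℕ
  compLeavesV [] = 0
  compLeavesV (leaf ∷ cs)         = suc (compLeavesV cs)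
  compLeavesV (bud ∷ cs)          = compLeavesV cs
  compLeavesV (edge true t ∷ cs)  = compLeaves t + compLeavesV cs
  compLeavesV (edge false t ∷ cs) = compLeavesV cs

mutual
  compBuds : ∀ {p} → Node p → ℕ
  compBuds (node cs) = compBudsV cs

  compBudsV : ∀ {p m} → Vec (Child p) m → ℕ
  compBudsV [] = 0
  compBudsV (leaf ∷ cs)         = compBudsV cs
  compBudsV (bud ∷ cs)          = suc (compBudsV cs)
  compBudsV (edge true t ∷ cs)  = compBuds t + compBudsV cs
  compBudsV (edge false t ∷ cs) = compBudsV cs

Charge01 : ∀ {p} → Node p → Set
Charge01 t = charge t ≡ + 0 ⊎ charge t ≡ + 1

-- an R-tree is either the bare root half-edge carrying a leaf, or a tree
data RTree (p : ℕ) : Set where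
  rootLeaf : RTree p
  tree     : Node p → RTree p

IsEnrichedR : ∀ {p} → RTree p → Set
IsEnrichedR rootLeaf = ⊤
IsEnrichedR (tree t) = charge t ≡ + 1 × ForallNonF Charge01 t

leavesR : ∀ {p} → RTree p → ℕ
leavesR rootLeaf = 1
leavesR (tree t) = leaves t

componentsR : ∀ {p} → RTree p → ℕ
componentsR rootLeaf = 0
componentsR (tree t) = components t

IsEnrichedS : ∀ {p} → Node p → Set
IsEnrichedS t = charge t ≡ + 0 × ForallNonF Charge01 t

BalancedTop : ∀ {p} → Node p → Set
BalancedTop t = compLeaves t ≡ compBuds t

-- every component of F is balanced (components ↔ their top vertices)
IsEnrichedS̃ : ∀ {p} → Node p → Set
IsEnrichedS̃ t = BalancedTop t × ForallNonF BalancedTop t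

EnrR : ℕ → ℕ → ℕ → Set
EnrR p n k = Σ (RTree p) (λ r → IsEnrichedR r × leavesR r ≡ n × componentsR r ≡ k)

EnrS : ℕ → ℕ → ℕ → Set
EnrS p n k = Σ (Node p) (λ t → IsEnrichedS t × leaves t ≡ n × components t ≡ k)

EnrS̃ : ℕ → ℕ → ℕ → Set
EnrS̃ p n k = Σ (Node p) (λ t → IsEnrichedS̃ t × leaves t ≡ n × components t ≡ k)

ZeroConst : Series → Set
ZeroConst F = ∀ k → F 0 k ≡ 0

SolvesRS : ℕ → Series → Series → Set
SolvesRS p R S = ZeroConst R × ZeroConst S
  × (∀ n k → R n k ≡ (zₛ +ₛ uₛ (Φ₁ p R S)) n k)
  × (∀ n k → S n k ≡ uₛ (Φ₂ p R S) n k)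

SolvesS̃ : ℕ → Series → Set
SolvesS̃ p T = ZeroConst T × (∀ n k → T n k ≡ uₛ (Φ₂ p zₛ T) n k)

-- Cutting an enriched tree along the edges not in F isolates the component of its root: a plane tree with
-- ℓ vertices of degree p, hence with (p − 2)ℓ + 1 free child positions. There are t_{(p−2)ℓ+2} such components
-- (the forest formula r/(r + (p − 1)ℓ) · binom(r + (p − 1)ℓ, ℓ) at r = 1), and each free position carries a bud,
-- a leaf, or an edge not in F leading to a subtree. In an enriched R- or S-tree these subtrees are enriched of
-- charge 1 or 0, and a leaf is the trivial R-tree, so a component with i buds, i + δ entries of charge 1 and
-- j of charge 0 has charge δ; the arrangement of the entries is a word counted by the multinomial
-- (2i + δ + j; i, i + δ, j). Summing over components gives z + uΦ₁(R, S) for δ = 1 and uΦ₂(R, S) for δ = 0,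
-- each cut edge adding a component. For S̃-trees the root component is balanced, its leaves play the role of x,
-- and the subtrees are S̃-trees, giving uΦ₂(z, S̃). The right-hand sides only involve coefficients of lower
-- u-degree, so the systems have unique solutions, computed by iteration, and each count is an explicit
-- bijection with Fin of the coefficient.

module Submission where

open import Defs
open import Axiom.UniquenessOfIdentityProofs.WithK using (uip)
open import Data.Bool using (true; false; if_then_else_; T)
open import Data.Empty using (⊥; ⊥-elim)
open import Data.Fin using (Fin; zero)
open import Data.Fin.Properties using (+↔⊎; *↔×; 0↔⊥; ¬Fin0)
open import Data.Fin.Permutation using () renaming (↔⇒≡ to Fin-injective)
import Data.Integer as ℤ
import Data.Integer.Properties as ℤ
import Data.Integer.Tactic.RingSolver as ℤ-Solver
open import Data.List using (List; []; _∷_; length; _++_; take; drop; map)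
open import Data.Nat.ListAction using (sum)
open import Data.Nat.ListAction.Properties using (sum-++)
open import Data.List.Properties using (length-++; length-map; map-++; take++drop≡id)
open import Data.List.Relation.Unary.All using (All; []; _∷_)
import Data.List.Relation.Unary.All as All
import Data.List.Relation.Unary.All.Properties as All
open import Data.Maybe using (Maybe; just; nothing)
open import Data.Nat using (ℕ; zero; suc; _+_; _*_; _∸_; _≤_; _>_; >-nonZero; _≤?_; z≤n; s≤s; _!; _/_; NonZero; _≡ᵇ_)
open import Data.Nat.Properties
open import Algebra.Properties.CommutativeSemigroup +-commutativeSemigroup using (x∙yz≈y∙xz)
open import Data.Nat.DivMod using (m*n/n≡m)
open import Data.Nat.Tactic.RingSolver using (solve-∀)
open import Data.Product using (Σ; _×_; _,_; proj₁; proj₂)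
open import Data.Product.Function.Dependent.Propositional using (Σ-↔)
open import Data.Product.Function.NonDependent.Propositional using (_×-↔_)
open import Data.Sum using (_⊎_; inj₁; inj₂)
open import Data.Sum.Function.Propositional using (_⊎-↔_)
open import Data.Unit using (⊤; tt)
open import Data.Unit.Properties using (⊤-irrelevant)
open import Data.Vec using (Vec; []; _∷_; splitAt) renaming (_++_ to _++ᵥ_)
import Data.Vec as Vec
open import Function using (_∘_)
open import Function.Bundles using (_↔_; _⇔_; Inverse; Equivalence; mk↔ₛ′; mk⇔)
open import Function.Properties.Equivalence using () renaming (trans to ⇔-trans)
open import Function.Properties.Inverse using (↔-refl; ↔-sym; ↔-trans)
open import Function.Related.TypeIsomorphisms using (Σ-assoc)
open import Relation.Binary.PropositionalEquality
open import Relation.Nullary using (¬_; Dec; yes; no)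
open import Relation.Nullary.Irrelevant using (Irrelevant)

open Inverse using (to; from; strictlyInverseˡ; strictlyInverseʳ)

infixr 2 _⨾_
_⨾_ : ∀ {A B C : Set} → A ↔ B → B ↔ C → A ↔ C
_⨾_ = ↔-trans

Σ-congʳ : ∀ {A : Set} {B C : A → Set} → (∀ a → B a ↔ C a) → Σ A B ↔ Σ A C
Σ-congʳ e = Σ-↔ ↔-refl (λ {a} → e a)

Σ-congˡ : ∀ {A A′ : Set} {B : A′ → Set} (e : A ↔ A′) → Σ A (B ∘ to e) ↔ Σ A′ B
Σ-congˡ e = Σ-↔ e ↔-refl

×-irrelevant : ∀ {A B : Set} → Irrelevant A → Irrelevant B → Irrelevant (A × B)
×-irrelevant irrA irrB (a , b) (a′ , b′) = cong₂ _,_ (irrA a a′) (irrB b b′)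

Σ-≡-irrelevant : ∀ {A : Set} {P : A → Set} → (∀ a → Irrelevant (P a)) →
                 {x y : Σ A P} → proj₁ x ≡ proj₁ y → x ≡ y
Σ-≡-irrelevant irr {a , u} {.a , v} refl = cong (a ,_) (irr a u v)

irrelevant-⇔⇒↔ : ∀ {A B : Set} → Irrelevant A → Irrelevant B → A ⇔ B → A ↔ B
irrelevant-⇔⇒↔ irrA irrB e =
  mk↔ₛ′ (Equivalence.to e) (Equivalence.from e) (λ _ → irrB _ _) (λ _ → irrA _ _)

Σ-cong-irrelevant : ∀ {A : Set} {P Q : A → Set} → (∀ a → Irrelevant (P a)) → (∀ a → Irrelevant (Q a)) →
                    (∀ a → P a ⇔ Q a) → Σ A P ↔ Σ A Q
Σ-cong-irrelevant irrP irrQ e = Σ-congʳ (λ a → irrelevant-⇔⇒↔ (irrP a) (irrQ a) (e a))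

¬⇒↔Fin0 : ∀ {A : Set} → ¬ A → A ↔ Fin 0
¬⇒↔Fin0 ¬a = mk↔ₛ′ (⊥-elim ∘ ¬a) (λ ()) (λ ()) (⊥-elim ∘ ¬a)

singleton↔Fin1 : ∀ {A : Set} (a : A) → (∀ x → x ≡ a) → A ↔ Fin 1
singleton↔Fin1 a unique = mk↔ₛ′ (λ _ → zero) (λ _ → a) (λ { zero → refl }) (sym ∘ unique)

≡⇒Fin↔ : ∀ {m n} → m ≡ n → Fin m ↔ Fin n
≡⇒Fin↔ refl = ↔-refl

Σ≤ : ℕ → (ℕ → Set) → Set
Σ≤ n B = Σ ℕ (λ i → i ≤ n × B i)

Σ≤-congʳ : ∀ {n} {B C : ℕ → Set} → (∀ i → i ≤ n → B i ↔ C i) → Σ≤ n B ↔ Σ≤ n C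
Σ≤-congʳ e = Σ-congʳ λ i → Σ-↔ ↔-refl (λ {i≤n} → e i i≤n)

Σ≤-unbound : ∀ {B : ℕ → Set} n → (∀ i → B i → i ≤ n) → Σ≤ n B ↔ Σ ℕ B
Σ≤-unbound {B} n bound = mk↔ₛ′
  (λ { (i , _ , b) → i , b })
  (λ { (i , b) → i , bound i b , b })
  (λ _ → refl)
  (λ { (i , _ , b) → cong (λ le → i , le , b) (≤-irrelevant _ _) })

Σ≤-suc : ∀ {B : ℕ → Set} n → Σ≤ (suc n) B ↔ (Σ≤ n B ⊎ B (suc n))
Σ≤-suc {B} n = mk↔ₛ′ split′ join split∘join (λ { (i , le , b) → join∘split i le b (i ≤? n) })
  where
  split : ∀ i → i ≤ suc n → B i → Dec (i ≤ n) → Σ≤ n B ⊎ B (suc n)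
  split i _ b (yes i≤n) = inj₁ (i , i≤n , b)
  split i le b (no i≰n) = inj₂ (subst B (≤-antisym le (≰⇒> i≰n)) b)
  split′ : Σ≤ (suc n) B → Σ≤ n B ⊎ B (suc n)
  split′ (i , le , b) = split i le b (i ≤? n)
  join : Σ≤ n B ⊎ B (suc n) → Σ≤ (suc n) B
  join (inj₁ (i , i≤n , b)) = i , m≤n⇒m≤1+n i≤n , b
  join (inj₂ b) = suc n , ≤-refl , b
  split∘join : ∀ y → split′ (join y) ≡ y
  split∘join (inj₁ (i , i≤n , b)) with i ≤? n
  ... | yes _ = cong (λ le → inj₁ (i , le , b)) (≤-irrelevant _ _)
  ... | no i≰n = ⊥-elim (i≰n i≤n)
  split∘join (inj₂ b) with suc n ≤? n
  ... | yes 1+n≤n = ⊥-elim (1+n≰n 1+n≤n)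
  ... | no _ = cong (λ eq → inj₂ (subst B eq b)) (uip _ refl)
  join-subst : ∀ {i} (eq : i ≡ suc n) (le : i ≤ suc n) b → join (inj₂ (subst B eq b)) ≡ (i , le , b)
  join-subst refl le b = cong (λ le → suc n , le , b) (≤-irrelevant _ _)
  join∘split : ∀ i le b d → join (split i le b d) ≡ (i , le , b)
  join∘split i le b (yes i≤n) = cong (λ le → i , le , b) (≤-irrelevant _ _)
  join∘split i le b (no i≰n) = join-subst _ le b

Fin-sumTo : ∀ n (f : ℕ → ℕ) → Fin (sumTo n f) ↔ Σ≤ n (Fin ∘ f)
Fin-sumTo zero f = mk↔ₛ′
  (λ x → 0 , z≤n , x)
  (λ { (zero , _ , x) → x })
  (λ { (zero , z≤n , x) → refl })
  (λ _ → refl)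
Fin-sumTo (suc n) f = +↔⊎ ⨾ (Fin-sumTo n f ⊎-↔ ↔-refl) ⨾ ↔-sym (Σ≤-suc n)

Fin-if : ∀ m n x → Fin (if m ≡ᵇ n then x else 0) ↔ (m ≡ n × Fin x)
Fin-if m n x with m ≡ᵇ n in eq
... | true  = mk↔ₛ′ (λ y → ≡ᵇ⇒≡ m n (subst T (sym eq) tt) , y) proj₂
                   (λ { (_ , y) → cong (_, y) (≡-irrelevant _ _) }) (λ _ → refl)
... | false = ¬⇒↔Fin0 (λ ()) ⨾ ↔-sym (¬⇒↔Fin0 (λ (m≡n , _) → subst T eq (≡⇒≡ᵇ m n m≡n)))

-- Bigraded combinatorial classes: zdeg counts leaves (the variable z), udeg counts components (u)

record Class : Set₁ where
  constructor mkClass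
  field
    Obj  : Set
    zdeg : Obj → ℕ
    udeg : Obj → ℕ
open Class public

Of : Class → ℕ → ℕ → Set
Of C n k = Σ (Obj C) (λ x → zdeg C x ≡ n × udeg C x ≡ k)

Counts : Series → Class → ℕ → Set
Counts f C k = ∀ n j → j ≤ k → Of C n j ↔ Fin (f n j)

degrees-irrelevant : ∀ {a b c d : ℕ} → Irrelevant (a ≡ b × c ≡ d)
degrees-irrelevant = ×-irrelevant ≡-irrelevant ≡-irrelevant

constraints-irrelevant : ∀ {a b c d e f g h : ℕ} → Irrelevant ((a ≡ b × c ≡ d) × e ≡ f × g ≡ h)
constraints-irrelevant = ×-irrelevant degrees-irrelevant degrees-irrelevant

Of-cong : ∀ {C D} (φ : Obj C ↔ Obj D) →
          (∀ x → zdeg D (to φ x) ≡ zdeg C x) → (∀ x → udeg D (to φ x) ≡ udeg C x) →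
          ∀ n k → Of C n k ↔ Of D n k
Of-cong φ z u n k =
  Σ-cong-irrelevant (λ _ → degrees-irrelevant) (λ _ → degrees-irrelevant)
    (λ x → mk⇔ (λ (p , q) → trans (z x) p , trans (u x) q) (λ (p , q) → trans (sym (z x)) p , trans (sym (u x)) q))
  ⨾ Σ-congˡ φ

counts-cong : ∀ {C D f k} (φ : Obj C ↔ Obj D) →
              (∀ x → zdeg D (to φ x) ≡ zdeg C x) → (∀ x → udeg D (to φ x) ≡ udeg C x) →
              Counts f C k → Counts f D k
counts-cong φ z u count n j j≤k = ↔-sym (Of-cong φ z u n j) ⨾ count n j j≤k

counts-mono : ∀ {C f k k′} → k′ ≤ k → Counts f C k → Counts f C k′
counts-mono k′≤k count n j j≤k′ = count n j (≤-trans j≤k′ k′≤k)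

counts-diagonal : ∀ {C} (F : ℕ → Series) → (∀ k → Counts (F k) C k) → ∀ k → Counts (λ n j → F j n j) C k
counts-diagonal F count k n j _ = count j n j ≤-refl

counted-equal : ∀ {C f g k} → Counts f C k → Counts g C k → ∀ n → f n k ≡ g n k
counted-equal count count′ n = Fin-injective (↔-sym (count n _ ≤-refl) ⨾ count′ n _ ≤-refl)

unit : Class
unit = mkClass ⊤ (λ _ → 0) (λ _ → 0)

counts-unit : ∀ {k} → Counts oneₛ unit k
counts-unit zero    zero    _ = singleton↔Fin1 (tt , refl , refl) (λ { (tt , refl , refl) → refl })
counts-unit zero    (suc j) _ = ¬⇒↔Fin0 (λ ())
counts-unit (suc n) j       _ = ¬⇒↔Fin0 (λ ())

_⊗_ : Class → Class → Class
C ⊗ D = mkClass (Obj C × Obj D) (λ (x , y) → zdeg C x + zdeg D y) (λ (x , y) → udeg C x + udeg D y)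

Of-⊗ : ∀ C D n k → Of (C ⊗ D) n k ↔ Σ≤ n (λ a → Σ≤ k (λ b → Of C a b × Of D (n ∸ a) (k ∸ b)))
Of-⊗ C D n k = mk↔ₛ′ split join split∘join join∘split
  where
  Split : Set
  Split = Σ≤ n (λ a → Σ≤ k (λ b → Of C a b × Of D (n ∸ a) (k ∸ b)))
  split : Of (C ⊗ D) n k → Split
  split ((x , y) , zx+zy≡n , ux+uy≡k) =
    zdeg C x , subst (zdeg C x ≤_) zx+zy≡n (m≤m+n _ _) , udeg C x , subst (udeg C x ≤_) ux+uy≡k (m≤m+n _ _) ,
    (x , refl , refl) ,
    (y , trans (sym (m+n∸m≡n (zdeg C x) (zdeg D y))) (cong (_∸ zdeg C x) zx+zy≡n) ,
         trans (sym (m+n∸m≡n (udeg C x) (udeg D y))) (cong (_∸ udeg C x) ux+uy≡k))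
  join : Split → Of (C ⊗ D) n k
  join (a , a≤n , b , b≤k , (x , refl , refl) , (y , zy≡n∸a , uy≡k∸b)) =
    (x , y) , trans (cong (a +_) zy≡n∸a) (m+[n∸m]≡n a≤n) , trans (cong (b +_) uy≡k∸b) (m+[n∸m]≡n b≤k)
  split∘join : ∀ s → split (join s) ≡ s
  split∘join (a , a≤n , b , b≤k , (x , refl , refl) , (y , zy≡n∸a , uy≡k∸b)) =
    cong₂ (λ (a≤n , b≤k) (zy≡n∸a , uy≡k∸b) → a , a≤n , b , b≤k , (x , refl , refl) , (y , zy≡n∸a , uy≡k∸b))
      (×-irrelevant ≤-irrelevant ≤-irrelevant _ _) (degrees-irrelevant _ _)
  join∘split : ∀ o → join (split o) ≡ o
  join∘split o = Σ-≡-irrelevant (λ _ → degrees-irrelevant) refl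

counts-⊗ : ∀ {C D f g k} → Counts f C k → Counts g D k → Counts (f *ₛ g) (C ⊗ D) k
counts-⊗ {C} {D} countC countD n j j≤k =
  Of-⊗ C D n j ⨾ ↔-sym
    (Fin-sumTo n _ ⨾ Σ≤-congʳ λ a _ → Fin-sumTo j _ ⨾ Σ≤-congʳ λ b b≤j →
       *↔× ⨾ ↔-sym (countC a b (≤-trans b≤j j≤k) ×-↔ countD (n ∸ a) (j ∸ b) (≤-trans (m∸n≤m j b) j≤k)))

sumBy : ∀ {A : Set} → (A → ℕ) → List A → ℕ
sumBy f = sum ∘ map f

sumBy-++ : ∀ {A : Set} (f : A → ℕ) xs ys → sumBy f (xs ++ ys) ≡ sumBy f xs + sumBy f ys
sumBy-++ f xs ys = trans (cong sum (map-++ f xs ys)) (sum-++ (map f xs) (map f ys))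

sumByᵥ : ∀ {A : Set} {m} → (A → ℕ) → Vec A m → ℕ
sumByᵥ f = Vec.sum ∘ Vec.map f

Tuples : Class → ℕ → Class
Tuples C i = mkClass (Vec (Obj C) i) (sumByᵥ (zdeg C)) (sumByᵥ (udeg C))

counts-tuples : ∀ {C f k} → Counts f C k → ∀ i → Counts (f ^ₛ i) (Tuples C i) k
counts-tuples count zero    = counts-cong {unit} (mk↔ₛ′ (λ _ → []) (λ _ → tt) (λ { [] → refl }) (λ _ → refl))
                                (λ _ → refl) (λ _ → refl) counts-unit
counts-tuples {C} count (suc i) = counts-cong {C ⊗ Tuples C i} cons↔ (λ _ → refl) (λ _ → refl)
                                    (counts-⊗ count (counts-tuples count i))
  where
  cons↔ : (Obj C × Vec (Obj C) i) ↔ Vec (Obj C) (suc i)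
  cons↔ = mk↔ₛ′ (λ (x , xs) → x ∷ xs) (λ { (x ∷ xs) → x , xs }) (λ { (x ∷ xs) → refl }) (λ { (x , xs) → refl })

Positive : Class → ℕ → Set
Positive C k = ∀ x → udeg C x ≤ k → 1 ≤ zdeg C x

length≤zdeg : ∀ {C k i} → Positive C k → (v : Vec (Obj C) i) → sumByᵥ (udeg C) v ≤ k → i ≤ sumByᵥ (zdeg C) v
length≤zdeg pos []       _  = z≤n
length≤zdeg pos (x ∷ xs) le =
  +-mono-≤ (pos x (≤-trans (m≤m+n _ _) le)) (length≤zdeg pos xs (≤-trans (m≤n+m _ _) le))

-- Multinomial coefficients count words

data Letter : Set where
  Lb Lx Ly : Letter

#b #x #y : List Letter → ℕ
#b []       = 0
#b (Lb ∷ w) = suc (#b w)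
#b (_  ∷ w) = #b w
#x []       = 0
#x (Lx ∷ w) = suc (#x w)
#x (_  ∷ w) = #x w
#y []       = 0
#y (Ly ∷ w) = suc (#y w)
#y (_  ∷ w) = #y w

length≡#b+#x+#y : ∀ w → length w ≡ #b w + #x w + #y w
length≡#b+#x+#y []       = refl
length≡#b+#x+#y (Lb ∷ w) = cong suc (length≡#b+#x+#y w)
length≡#b+#x+#y (Lx ∷ w) = trans (cong suc (length≡#b+#x+#y w)) (sym (cong (_+ #y w) (+-suc (#b w) (#x w))))
length≡#b+#x+#y (Ly ∷ w) = trans (cong suc (length≡#b+#x+#y w)) (sym (+-suc (#b w + #x w) (#y w)))

HasCounts : List Letter → ℕ → ℕ → ℕ → Set
HasCounts w a b c = #b w ≡ a × #x w ≡ b × #y w ≡ c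

HasCounts-irrelevant : ∀ {w a b c} → Irrelevant (HasCounts w a b c)
HasCounts-irrelevant = ×-irrelevant ≡-irrelevant degrees-irrelevant

Word : ℕ → ℕ → ℕ → Set
Word a b c = Σ (List Letter) (λ w → HasCounts w a b c)

WordOfLength : ℕ → ℕ → ℕ → ℕ → Set
WordOfLength n a b c = Σ (List Letter) (λ w → length w ≡ n × HasCounts w a b c)

onPred : ℕ → (ℕ → ℕ) → ℕ
onPred zero    f = 0
onPred (suc m) f = f m

wordCount : ℕ → ℕ → ℕ → ℕ → ℕ
wordCount zero    zero zero zero = 1
wordCount zero    _    _    _    = 0
wordCount (suc n) a    b    c    =
  onPred a (λ a → wordCount n a b c) + onPred b (λ b → wordCount n a b c) + onPred c (λ c → wordCount n a b c)

Headed : Letter → ℕ → ℕ → ℕ → ℕ → Set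
Headed ℓ n a b c = Σ (List Letter) (λ w → length w ≡ n × HasCounts (ℓ ∷ w) a b c)

length-counts-irrelevant : ∀ {n a b c} (w w′ : List Letter) → Irrelevant (length w ≡ n × HasCounts w′ a b c)
length-counts-irrelevant _ w′ = ×-irrelevant ≡-irrelevant (HasCounts-irrelevant {w′})

WordOfLength-suc : ∀ n a b c → WordOfLength (suc n) a b c ↔ ((Headed Lb n a b c ⊎ Headed Lx n a b c) ⊎ Headed Ly n a b c)
WordOfLength-suc n a b c = mk↔ₛ′
  (λ { (Lb ∷ w , len , h) → inj₁ (inj₁ (w , suc-injective len , h))
     ; (Lx ∷ w , len , h) → inj₁ (inj₂ (w , suc-injective len , h))
     ; (Ly ∷ w , len , h) → inj₂ (w , suc-injective len , h) })
  (λ { (inj₁ (inj₁ (w , len , h))) → Lb ∷ w , cong suc len , h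
     ; (inj₁ (inj₂ (w , len , h))) → Lx ∷ w , cong suc len , h
     ; (inj₂ (w , len , h))        → Ly ∷ w , cong suc len , h })
  (λ { (inj₁ (inj₁ (w , _))) → cong (λ e → inj₁ (inj₁ (w , e))) (irr w (Lb ∷ w) _ _)
     ; (inj₁ (inj₂ (w , _))) → cong (λ e → inj₁ (inj₂ (w , e))) (irr w (Lx ∷ w) _ _)
     ; (inj₂ (w , _))        → cong (λ e → inj₂ (w , e)) (irr w (Ly ∷ w) _ _) })
  (λ { (Lb ∷ _ , _) → Σ-≡-irrelevant (λ w → irr w w) refl
     ; (Lx ∷ _ , _) → Σ-≡-irrelevant (λ w → irr w w) refl
     ; (Ly ∷ _ , _) → Σ-≡-irrelevant (λ w → irr w w) refl })
  where irr = length-counts-irrelevant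

WordOfLength↔wordCount : ∀ n a b c → WordOfLength n a b c ↔ Fin (wordCount n a b c)
WordOfLength↔wordCount zero zero zero zero =
  singleton↔Fin1 ([] , refl , refl , refl , refl) (λ { ([] , refl , refl , refl , refl) → refl })
WordOfLength↔wordCount zero zero zero (suc c) = ¬⇒↔Fin0 (λ { ([] , _ , _ , _ , ()) })
WordOfLength↔wordCount zero zero (suc b) c    = ¬⇒↔Fin0 (λ { ([] , _ , _ , () , _) })
WordOfLength↔wordCount zero (suc a) b c       = ¬⇒↔Fin0 (λ { ([] , _ , () , _ , _) })
WordOfLength↔wordCount (suc n) a b c =
  WordOfLength-suc n a b c ⨾ ((headed-b a ⊎-↔ headed-x b) ⊎-↔ headed-y c) ⨾ ↔-sym (+↔⊎ ⨾ (+↔⊎ ⊎-↔ ↔-refl))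
  where
  irr = length-counts-irrelevant
  headed-b : ∀ a → Headed Lb n a b c ↔ Fin (onPred a (λ a → wordCount n a b c))
  headed-b zero    = ¬⇒↔Fin0 (λ { (_ , _ , () , _) })
  headed-b (suc a) = Σ-cong-irrelevant (λ w → irr w (Lb ∷ w)) (λ w → irr w w)
    (λ _ → mk⇔ (λ (l , e , h) → l , suc-injective e , h) (λ (l , e , h) → l , cong suc e , h))
    ⨾ WordOfLength↔wordCount n a b c
  headed-x : ∀ b → Headed Lx n a b c ↔ Fin (onPred b (λ b → wordCount n a b c))
  headed-x zero    = ¬⇒↔Fin0 (λ { (_ , _ , _ , () , _) })
  headed-x (suc b) = Σ-cong-irrelevant (λ w → irr w (Lx ∷ w)) (λ w → irr w w)
    (λ _ → mk⇔ (λ (l , e₁ , e , e₃) → l , e₁ , suc-injective e , e₃) (λ (l , e₁ , e , e₃) → l , e₁ , cong suc e , e₃))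
    ⨾ WordOfLength↔wordCount n a b c
  headed-y : ∀ c → Headed Ly n a b c ↔ Fin (onPred c (λ c → wordCount n a b c))
  headed-y zero    = ¬⇒↔Fin0 (λ { (_ , _ , _ , _ , ()) })
  headed-y (suc c) = Σ-cong-irrelevant (λ w → irr w (Ly ∷ w)) (λ w → irr w w)
    (λ _ → mk⇔ (λ (l , e₁ , e₂ , e) → l , e₁ , e₂ , suc-injective e) (λ (l , e₁ , e₂ , e) → l , e₁ , e₂ , cong suc e))
    ⨾ WordOfLength↔wordCount n a b c

wordCount-factorials : ∀ n a b c → a + b + c ≡ n → wordCount n a b c * (a ! * b ! * c !) ≡ n !
wordCount-factorials zero zero zero zero refl = refl
wordCount-factorials (suc n) a b c a+b+c≡1+n = begin
  (onPred a W₁ + onPred b W₂ + onPred c W₃) * D           ≡⟨ distrib (onPred a W₁) (onPred b W₂) (onPred c W₃) D ⟩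
  onPred a W₁ * D + onPred b W₂ * D + onPred c W₃ * D     ≡⟨ cong₂ _+_ (cong₂ _+_ (first-b a a+b+c≡1+n) (first-x b a+b+c≡1+n))
                                                                      (first-y c a+b+c≡1+n) ⟩
  a * n ! + b * n ! + c * n !                             ≡⟨ distrib a b c (n !) ⟨
  (a + b + c) * n !                                       ≡⟨ cong (_* n !) a+b+c≡1+n ⟩
  suc n ! ∎
  where
  open ≡-Reasoning
  W₁ W₂ W₃ : ℕ → ℕ
  W₁ a = wordCount n a b c
  W₂ b = wordCount n a b c
  W₃ c = wordCount n a b c
  D = a ! * b ! * c !
  distrib : ∀ x y z d → (x + y + z) * d ≡ x * d + y * d + z * d
  distrib = solve-∀
  first-b : ∀ a → a + b + c ≡ suc n → onPred a (λ a → wordCount n a b c) * (a ! * b ! * c !) ≡ a * n !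
  first-b zero    _ = refl
  first-b (suc a) e = trans (shuffle (wordCount n a b c) (a !) (b !) (c !) a)
                            (cong (suc a *_) (wordCount-factorials n a b c (suc-injective e)))
    where
    shuffle : ∀ w x y z a → w * ((suc a * x) * y * z) ≡ suc a * (w * (x * y * z))
    shuffle = solve-∀
  first-x : ∀ b → a + b + c ≡ suc n → onPred b (λ b → wordCount n a b c) * (a ! * b ! * c !) ≡ b * n !
  first-x zero    _ = refl
  first-x (suc b) e = trans (shuffle (wordCount n a b c) (a !) (b !) (c !) b)
                            (cong (suc b *_) (wordCount-factorials n a b c (suc-injective (trans (cong (_+ c) (sym (+-suc a b))) e))))
    where
    shuffle : ∀ w x y z b → w * (x * (suc b * y) * z) ≡ suc b * (w * (x * y * z))
    shuffle = solve-∀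
  first-y : ∀ c → a + b + c ≡ suc n → onPred c (λ c → wordCount n a b c) * (a ! * b ! * c !) ≡ c * n !
  first-y zero    _ = refl
  first-y (suc c) e = trans (shuffle (wordCount n a b c) (a !) (b !) (c !) c)
                            (cong (suc c *_) (wordCount-factorials n a b c (suc-injective (trans (sym (+-suc (a + b) c)) e))))
    where
    shuffle : ∀ w x y z c → w * (x * y * (suc c * z)) ≡ suc c * (w * (x * y * z))
    shuffle = solve-∀

multinom≡wordCount : ∀ a b c → multinom a b c ≡ wordCount (a + b + c) a b c
multinom≡wordCount a b c =
  trans (cong (_/ (a ! * b ! * c !)) (sym (wordCount-factorials (a + b + c) a b c refl))) (m*n/n≡m _ _)
  where instance _ = m*n≢0 (a ! * b !) (c !) {{m*n≢0 (a !) (b !) {{a !≢0}} {{b !≢0}}}} {{c !≢0}}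

Word↔multinom : ∀ a b c → Word a b c ↔ Fin (multinom a b c)
Word↔multinom a b c =
  Σ-cong-irrelevant (λ w → HasCounts-irrelevant {w}) (λ w → ×-irrelevant ≡-irrelevant (HasCounts-irrelevant {w}))
    (λ w → mk⇔ (λ h@(ea , eb , ec) → trans (length≡#b+#x+#y w) (cong₂ _+_ (cong₂ _+_ ea eb) ec) , h) proj₂)
  ⨾ WordOfLength↔wordCount (a + b + c) a b c ⨾ ≡⇒Fin↔ (sym (multinom≡wordCount a b c))

splitAt-++ : ∀ {A : Set} {m n} (xs : Vec A m) (ys : Vec A n) → splitAt m (xs ++ᵥ ys) ≡ (xs , ys , refl)
splitAt-++ []       ys = refl
splitAt-++ (x ∷ xs) ys rewrite splitAt-++ xs ys = refl

length-take-+ : ∀ {A : Set} n {m} (l : List A) → length l ≡ n + m → length (take n l) ≡ n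
length-take-+ zero    l       _   = refl
length-take-+ (suc n) (x ∷ l) len = cong suc (length-take-+ n l (suc-injective len))

length-drop-+ : ∀ {A : Set} n {m} (l : List A) → length l ≡ n + m → length (drop n l) ≡ m
length-drop-+ zero    l       len = len
length-drop-+ (suc n) (x ∷ l) len = length-drop-+ n l (suc-injective len)

take-++ : ∀ {A : Set} n (xs ys : List A) → length xs ≡ n → take n (xs ++ ys) ≡ xs
take-++ _ []       ys refl = refl
take-++ _ (x ∷ xs) ys refl = cong (x ∷_) (take-++ _ xs ys refl)

drop-++ : ∀ {A : Set} n (xs ys : List A) → length xs ≡ n → drop n (xs ++ ys) ≡ ys
drop-++ _ []       ys refl = refl
drop-++ _ (x ∷ xs) ys refl = drop-++ _ xs ys refl

-- Plane trees of arity 1 + q with possibly empty child positions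

module Shapes (q : ℕ) where

  -- models an F-component: its empty child positions (slots) receive the leaves, buds and edges not in F
  data Shape : Set where
    shape : Vec (Maybe Shape) (suc q) → Shape

  mutual
    vertices : Shape → ℕ
    vertices (shape cs) = suc (verticesV cs)

    verticesV : ∀ {r} → Vec (Maybe Shape) r → ℕ
    verticesV []           = 0
    verticesV (nothing ∷ v) = verticesV v
    verticesV (just s ∷ v)  = vertices s + verticesV v

  mutual
    slots : Shape → ℕ
    slots (shape cs) = slotsV cs

    slotsV : ∀ {r} → Vec (Maybe Shape) r → ℕ
    slotsV []            = 0
    slotsV (nothing ∷ v) = suc (slotsV v)
    slotsV (just s ∷ v)  = slots s + slotsV v

  mutual
    slots≡1+q*vertices : ∀ s → slots s ≡ suc (q * vertices s)
    slots≡1+q*vertices (shape cs) = trans (slotsV≡ cs) (cong suc (sym (*-suc q (verticesV cs))))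

    slotsV≡ : ∀ {r} (v : Vec (Maybe Shape) r) → slotsV v ≡ r + q * verticesV v
    slotsV≡ []            = sym (*-zeroʳ q)
    slotsV≡ (nothing ∷ v) = cong suc (slotsV≡ v)
    slotsV≡ {suc r} (just s ∷ v) = begin
      slots s + slotsV v                         ≡⟨ cong₂ _+_ (slots≡1+q*vertices s) (slotsV≡ v) ⟩
      suc (q * vertices s) + (r + q * verticesV v) ≡⟨ regroup q r (vertices s) (verticesV v) ⟩
      suc r + q * (vertices s + verticesV v)     ∎
      where
      open ≡-Reasoning
      regroup : ∀ q r x y → suc (q * x) + (r + q * y) ≡ suc r + q * (x + y)
      regroup = solve-∀

  verticesV-++ : ∀ {m n} (xs : Vec (Maybe Shape) m) (ys : Vec (Maybe Shape) n) →
                 verticesV (xs ++ᵥ ys) ≡ verticesV xs + verticesV ys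
  verticesV-++ []            ys = refl
  verticesV-++ (nothing ∷ xs) ys = verticesV-++ xs ys
  verticesV-++ (just s ∷ xs)  ys = trans (cong (vertices s +_) (verticesV-++ xs ys)) (sym (+-assoc (vertices s) _ _))

  Forest : ℕ → ℕ → Set
  Forest r ℓ = Σ (Vec (Maybe Shape) r) (λ v → verticesV v ≡ ℓ)

  forests : ℕ → ℕ → ℕ
  forests zero    zero    = 1
  forests zero    (suc ℓ) = 0
  forests (suc r) zero    = forests r zero
  forests (suc r) (suc ℓ) = forests r (suc ℓ) + forests (suc q + r) ℓ

  Forest-suc : ∀ r ℓ → Forest (suc r) (suc ℓ) ↔ (Forest r (suc ℓ) ⊎ Forest (suc q + r) ℓ)
  Forest-suc r ℓ = mk↔ₛ′ split join split∘join join∘split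
    where
    split : Forest (suc r) (suc ℓ) → Forest r (suc ℓ) ⊎ Forest (suc q + r) ℓ
    split (nothing ∷ v , eq) = inj₁ (v , eq)
    split (just (shape cs) ∷ v , eq) = inj₂ (cs ++ᵥ v , trans (verticesV-++ cs v) (suc-injective eq))
    join : Forest r (suc ℓ) ⊎ Forest (suc q + r) ℓ → Forest (suc r) (suc ℓ)
    join (inj₁ (v , eq)) = nothing ∷ v , eq
    join (inj₂ (w , eq)) with splitAt (suc q) w
    ... | cs , v , refl = just (shape cs) ∷ v , cong suc (trans (sym (verticesV-++ cs v)) eq)
    split∘join : ∀ y → split (join y) ≡ y
    split∘join (inj₁ _) = refl
    split∘join (inj₂ (w , eq)) with splitAt (suc q) w
    ... | cs , v , refl = cong inj₂ (Σ-≡-irrelevant (λ _ → ≡-irrelevant) refl)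
    join∘split : ∀ x → join (split x) ≡ x
    join∘split (nothing ∷ v , eq) = refl
    join∘split (just (shape cs) ∷ v , eq) rewrite splitAt-++ cs v = Σ-≡-irrelevant (λ _ → ≡-irrelevant) refl

  Forest↔forests : ∀ r ℓ → Forest r ℓ ↔ Fin (forests r ℓ)
  Forest↔forests zero    zero    = singleton↔Fin1 ([] , refl) (λ { ([] , refl) → refl })
  Forest↔forests zero    (suc ℓ) = ¬⇒↔Fin0 (λ { ([] , ()) })
  Forest↔forests (suc r) zero    = all-empty ⨾ Forest↔forests r zero
    where
    all-empty : Forest (suc r) zero ↔ Forest r zero
    all-empty = mk↔ₛ′ (λ { (nothing ∷ v , eq) → v , eq ; (just (shape _) ∷ _ , ()) }) (λ (v , eq) → nothing ∷ v , eq)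
                      (λ _ → refl) (λ { (nothing ∷ v , eq) → refl ; (just (shape _) ∷ _ , ()) })
  Forest↔forests (suc r) (suc ℓ) =
    Forest-suc r ℓ ⨾ (Forest↔forests r (suc ℓ) ⊎-↔ Forest↔forests (suc q + r) ℓ) ⨾ ↔-sym +↔⊎

  forests-r-0 : ∀ r → forests r zero ≡ 1
  forests-r-0 zero    = refl
  forests-r-0 (suc r) = forests-r-0 r

  -- forests r ℓ is the classical r / (r + (1+q)ℓ) · binom(r + (1+q)ℓ, ℓ), cleared of denominators
  ClosedForm : ℕ → ℕ → Set
  ClosedForm r ℓ = forests r ℓ * ℓ ! * (r + q * ℓ) ! * (r + suc q * ℓ) ≡ r * (r + suc q * ℓ) !

  forests-closed-form-step : ∀ r ℓ → ClosedForm r (suc ℓ) → ClosedForm (suc q + r) ℓ → ClosedForm (suc r) (suc ℓ)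
  forests-closed-form-step r ℓ IH₁ IH₂ = *-cancelʳ-≡ _ _ N {{>-nonZero N>0}} (begin
    (a + b) * L ! * (D * (r + q * L) !) * suc N * N              ≡⟨ expand a b L (ℓ !) D ((r + q * L) !) (suc N) N ⟩
    (a * L ! * (r + q * L) ! * N) * D * suc N
      + (b * ℓ ! * (D * (r + q * L) !) * N) * L * suc N           ≡⟨ cong₂ (λ u v → u * D * suc N + v * L * suc N)
                                                                             IH₁ IH₂-shifted ⟩
    r * N ! * D * suc N + (suc q + r) * N ! * L * suc N          ≡⟨ collect r ℓ q (N !) ⟩
    suc r * (suc N * N !) * N                                     ∎)
    where
    open ≡-Reasoning
    L = suc ℓ
    a = forests r L
    b = forests (suc q + r) ℓ
    N = r + suc q * L
    D = suc (r + q * L)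
    N>0 : N > 0
    N>0 = <-≤-trans (s≤s z≤n) (m≤n+m (suc q * L) r)
    D≡ : suc q + r + q * ℓ ≡ D
    D≡ = shift q r ℓ
      where
      shift : ∀ q r ℓ → suc q + r + q * ℓ ≡ suc (r + q * suc ℓ)
      shift = solve-∀
    N≡ : suc q + r + suc q * ℓ ≡ N
    N≡ = shift q r ℓ
      where
      shift : ∀ q r ℓ → suc q + r + suc q * ℓ ≡ r + suc q * suc ℓ
      shift = solve-∀
    IH₂-shifted : b * ℓ ! * (D * (r + q * L) !) * N ≡ (suc q + r) * N !
    IH₂-shifted = subst₂ (λ d n → b * ℓ ! * d ! * n ≡ (suc q + r) * n !) D≡ N≡ IH₂
    expand : ∀ a b L fℓ D f M N → (a + b) * (L * fℓ) * (D * f) * M * N ≡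
             (a * (L * fℓ) * f * N) * D * M + (b * fℓ * (D * f) * N) * L * M
    expand = solve-∀
    collect : ∀ r ℓ q f → r * f * suc (r + q * suc ℓ) * suc (r + suc q * suc ℓ)
                          + (suc q + r) * f * suc ℓ * suc (r + suc q * suc ℓ)
                        ≡ suc r * (suc (r + suc q * suc ℓ) * f) * (r + suc q * suc ℓ)
    collect = solve-∀

  forests-closed-form : ∀ r ℓ → ClosedForm r ℓ
  forests-closed-form zero    zero    rewrite *-zeroʳ q = refl
  forests-closed-form zero    (suc ℓ) = refl
  forests-closed-form (suc r) zero    rewrite *-zeroʳ q | +-identityʳ r | forests-r-0 r =
    trans (cong (_* suc r) (*-identityˡ (suc r !))) (*-comm (suc r !) (suc r))
  forests-closed-form (suc r) (suc ℓ) =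
    forests-closed-form-step r ℓ (forests-closed-form r (suc ℓ)) (forests-closed-form (suc q + r) ℓ)

  forests-1≡fuss : ∀ ℓ → forests 1 ℓ ≡ fuss (2 + q) ℓ
  forests-1≡fuss ℓ = sym (trans (cong (_/ X) (sym cleared)) (m*n/n≡m (forests 1 ℓ) X))
    where
    X = ℓ ! * (q * ℓ + 1) !
    instance _ = m*n≢0 (ℓ !) ((q * ℓ + 1) !) {{ℓ !≢0}} {{(q * ℓ + 1) !≢0}}
    cleared : forests 1 ℓ * X ≡ (suc q * ℓ) !
    cleared = *-cancelʳ-≡ _ _ (suc (suc q * ℓ)) (begin
      forests 1 ℓ * X * suc (suc q * ℓ)
        ≡⟨ cong (_* suc (suc q * ℓ)) (sym (*-assoc (forests 1 ℓ) _ _)) ⟩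
      forests 1 ℓ * ℓ ! * (q * ℓ + 1) ! * suc (suc q * ℓ)
        ≡⟨ cong (λ m → forests 1 ℓ * ℓ ! * m ! * suc (suc q * ℓ)) (+-comm (q * ℓ) 1) ⟩
      forests 1 ℓ * ℓ ! * (1 + q * ℓ) ! * (1 + suc q * ℓ)
        ≡⟨ forests-closed-form 1 ℓ ⟩
      1 * (1 + suc q * ℓ) !
        ≡⟨ *-identityˡ _ ⟩
      suc (suc q * ℓ) * (suc q * ℓ) !
        ≡⟨ *-comm (suc (suc q * ℓ)) _ ⟩
      (suc q * ℓ) ! * suc (suc q * ℓ) ∎)
      where open ≡-Reasoning

  ShapeWithVertices : ℕ → Set
  ShapeWithVertices ℓ = Σ Shape (λ s → vertices s ≡ ℓ)

  ShapeWithVertices↔fuss : ∀ ℓ → ShapeWithVertices (suc ℓ) ↔ Fin (fuss (2 + q) (suc ℓ))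
  ShapeWithVertices↔fuss ℓ = single-tree ⨾ Forest↔forests 1 (suc ℓ) ⨾ ≡⇒Fin↔ (forests-1≡fuss (suc ℓ))
    where
    single-tree : ShapeWithVertices (suc ℓ) ↔ Forest 1 (suc ℓ)
    single-tree = mk↔ₛ′
      (λ (s , eq) → just s ∷ [] , trans (+-identityʳ _) eq)
      (λ { (just s ∷ [] , eq) → s , trans (sym (+-identityʳ _)) eq ; (nothing ∷ [] , ()) })
      (λ { (just s ∷ [] , eq) → Σ-≡-irrelevant (λ _ → ≡-irrelevant) refl ; (nothing ∷ [] , ()) })
      (λ _ → Σ-≡-irrelevant (λ _ → ≡-irrelevant) refl)

  ShapeWithSlots : ℕ → Set
  ShapeWithSlots m = Σ Shape (λ s → slots s ≡ m)

  -- for q ≥ 1 only ℓ with qℓ + 2 = m + 1 contributes to t_{m+1}, and shapes with ℓ vertices have qℓ + 1 slots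
  tcoef↔ShapeWithSlots : .{{NonZero q}} → ∀ m → Fin (tcoef (2 + q) (suc m)) ↔ ShapeWithSlots m
  tcoef↔ShapeWithSlots m =
    Fin-sumTo (suc m) _ ⨾ Σ≤-congʳ fibre ⨾ Σ≤-unbound (suc m) bound ⨾ by-vertices
    where
    Fibre : ℕ → Set
    Fibre zero    = ⊥
    Fibre (suc ℓ) = suc m ≡ q * suc ℓ + 2 × ShapeWithVertices (suc ℓ)
    fibre : ∀ ℓ → ℓ ≤ suc m → _ ↔ Fibre ℓ
    fibre zero    _ = 0↔⊥
    fibre (suc ℓ) _ = Fin-if _ _ _ ⨾ (↔-refl ×-↔ ↔-sym (ShapeWithVertices↔fuss ℓ))
    bound : ∀ ℓ → Fibre ℓ → ℓ ≤ suc m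
    bound (suc ℓ) (eq , _) = ≤-trans (m≤n*m (suc ℓ) q) (≤-trans (m≤m+n _ 2) (≤-reflexive (sym eq)))
    slots≡ : ∀ s ℓ → suc m ≡ q * suc ℓ + 2 → vertices s ≡ suc ℓ → slots s ≡ m
    slots≡ s ℓ eq v =
      trans (slots≡1+q*vertices s) (trans (cong (suc ∘ (q *_)) v) (suc-injective (trans (+-comm 2 _) (sym eq))))
    by-vertices : Σ ℕ Fibre ↔ ShapeWithSlots m
    by-vertices = mk↔ₛ′
      (λ { (suc ℓ , eq , s , v) → s , slots≡ s ℓ eq v })
      (λ { (shape cs , e) → suc (verticesV cs) ,
             trans (cong suc (sym e)) (trans (cong suc (slots≡1+q*vertices (shape cs))) (+-comm 2 _)) , shape cs , refl })
      (λ { (shape _ , _) → Σ-≡-irrelevant (λ _ → ≡-irrelevant) refl })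
      (λ { (suc ℓ , eq , shape cs , refl) → cong (λ eq → suc ℓ , eq , shape cs , refl) (≡-irrelevant _ _) })

  module _ (X : Set) where
    mutual
      data Filled : Set where
        filled : Vec Position (suc q) → Filled

      data Position : Set where
        slot    : X → Position
        subtree : Filled → Position

  mutual
    shapeOf : ∀ {X} → Filled X → Shape
    shapeOf (filled ps) = shape (shapeOfV ps)

    shapeOfV : ∀ {X r} → Vec (Position X) r → Vec (Maybe Shape) r
    shapeOfV []              = []
    shapeOfV (slot _ ∷ ps)    = nothing ∷ shapeOfV ps
    shapeOfV (subtree t ∷ ps) = just (shapeOf t) ∷ shapeOfV ps

  mutual
    contents : ∀ {X} → Filled X → List X
    contents (filled ps) = contentsV ps

    contentsV : ∀ {X r} → Vec (Position X) r → List X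
    contentsV []              = []
    contentsV (slot x ∷ ps)    = x ∷ contentsV ps
    contentsV (subtree t ∷ ps) = contents t ++ contentsV ps

  mutual
    length-contents : ∀ {X} (t : Filled X) → length (contents t) ≡ slots (shapeOf t)
    length-contents (filled ps) = length-contentsV ps

    length-contentsV : ∀ {X r} (ps : Vec (Position X) r) → length (contentsV ps) ≡ slotsV (shapeOfV ps)
    length-contentsV []              = refl
    length-contentsV (slot x ∷ ps)    = cong suc (length-contentsV ps)
    length-contentsV (subtree t ∷ ps) = trans (length-++ (contents t)) (cong₂ _+_ (length-contents t) (length-contentsV ps))

  mutual
    fill : ∀ {X} (s : Shape) (l : List X) → length l ≡ slots s → Filled X
    fill (shape cs) l len = filled (fillV cs l len)

    fillV : ∀ {X r} (cs : Vec (Maybe Shape) r) (l : List X) → length l ≡ slotsV cs → Vec (Position X) r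
    fillV []            _       _   = []
    fillV (nothing ∷ cs) (x ∷ l) len = slot x ∷ fillV cs l (suc-injective len)
    fillV (just s ∷ cs)  l       len =
      subtree (fill s (take (slots s) l) (length-take-+ _ l len)) ∷ fillV cs (drop (slots s) l) (length-drop-+ _ l len)

  fill-irrelevant : ∀ {X} s {l l′ : List X} (e : l ≡ l′) len len′ → fill s l len ≡ fill s l′ len′
  fill-irrelevant s refl len len′ = cong (fill s _) (≡-irrelevant len len′)

  fillV-irrelevant : ∀ {X r} (cs : Vec (Maybe Shape) r) {l l′ : List X} (e : l ≡ l′) len len′ →
                     fillV cs l len ≡ fillV cs l′ len′
  fillV-irrelevant cs refl len len′ = cong (fillV cs _) (≡-irrelevant len len′)

  mutual
    shapeOf-fill : ∀ {X} s (l : List X) len → shapeOf (fill s l len) ≡ s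
    shapeOf-fill (shape cs) l len = cong shape (shapeOfV-fillV cs l len)

    shapeOfV-fillV : ∀ {X r} (cs : Vec (Maybe Shape) r) (l : List X) len → shapeOfV (fillV cs l len) ≡ cs
    shapeOfV-fillV []            _       _ = refl
    shapeOfV-fillV (nothing ∷ cs) (x ∷ l) _ = cong (nothing ∷_) (shapeOfV-fillV cs l _)
    shapeOfV-fillV (just s ∷ cs)  l       _ = cong₂ (λ s cs → just s ∷ cs) (shapeOf-fill s _ _) (shapeOfV-fillV cs _ _)

  mutual
    contents-fill : ∀ {X} s (l : List X) len → contents (fill s l len) ≡ l
    contents-fill (shape cs) l len = contentsV-fillV cs l len

    contentsV-fillV : ∀ {X r} (cs : Vec (Maybe Shape) r) (l : List X) len → contentsV (fillV cs l len) ≡ l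
    contentsV-fillV []            []      _ = refl
    contentsV-fillV (nothing ∷ cs) (x ∷ l) _ = cong (x ∷_) (contentsV-fillV cs l _)
    contentsV-fillV (just s ∷ cs)  l       _ =
      trans (cong₂ _++_ (contents-fill s _ _) (contentsV-fillV cs _ _)) (take++drop≡id (slots s) l)

  mutual
    fill-contents : ∀ {X} (t : Filled X) len → fill (shapeOf t) (contents t) len ≡ t
    fill-contents (filled ps) len = cong filled (fillV-contentsV ps len)

    fillV-contentsV : ∀ {X r} (ps : Vec (Position X) r) len → fillV (shapeOfV ps) (contentsV ps) len ≡ ps
    fillV-contentsV []              _ = refl
    fillV-contentsV (slot x ∷ ps)    _ = cong (slot x ∷_) (fillV-contentsV ps _)
    fillV-contentsV (subtree t ∷ ps) _ = cong₂ (λ t ps → subtree t ∷ ps)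
      (trans (fill-irrelevant (shapeOf t) (take-++ _ (contents t) (contentsV ps) (length-contents t)) _ (length-contents t))
             (fill-contents t _))
      (trans (fillV-irrelevant (shapeOfV ps) (drop-++ _ (contents t) (contentsV ps) (length-contents t)) _ (length-contentsV ps))
             (fillV-contentsV ps _))

  Filled↔shape×contents : ∀ {X} → Filled X ↔ Σ Shape (λ s → Σ (List X) (λ l → length l ≡ slots s))
  Filled↔shape×contents = mk↔ₛ′
    (λ t → shapeOf t , contents t , length-contents t)
    (λ (s , l , len) → fill s l len)
    (λ (s , l , len) → pair-≡ (shapeOf-fill s l len) (contents-fill s l len))
    (λ t → fill-contents t (length-contents t))
    where
    pair-≡ : ∀ {X} {s s′ : Shape} {l l′ : List X} {len len′} → s′ ≡ s → l′ ≡ l →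
             _≡_ {A = Σ Shape (λ s → Σ (List X) (λ l → length l ≡ slots s))} (s′ , l′ , len′) (s , l , len)
    pair-≡ {s = s} {l = l} refl refl = cong (λ len → s , l , len) (≡-irrelevant _ _)

module Decorations (q : ℕ) (𝒳 𝒴 : Class) where
  open Shapes q

  data Deco : Set where
    bud : Deco
    inX : Obj 𝒳 → Deco
    inY : Obj 𝒴 → Deco

  letter : Deco → Letter
  letter bud     = Lb
  letter (inX _) = Lx
  letter (inY _) = Ly

  degᴰ : (Obj 𝒳 → ℕ) → (Obj 𝒴 → ℕ) → Deco → ℕ
  degᴰ f g bud     = 0
  degᴰ f g (inX x) = f x
  degᴰ f g (inY y) = g y

  xs-of : (d : List Deco) → Vec (Obj 𝒳) (#x (map letter d))
  xs-of []          = []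
  xs-of (bud ∷ d)   = xs-of d
  xs-of (inX x ∷ d) = x ∷ xs-of d
  xs-of (inY _ ∷ d) = xs-of d

  ys-of : (d : List Deco) → Vec (Obj 𝒴) (#y (map letter d))
  ys-of []          = []
  ys-of (bud ∷ d)   = ys-of d
  ys-of (inX _ ∷ d) = ys-of d
  ys-of (inY y ∷ d) = y ∷ ys-of d

  merge : (w : List Letter) → Vec (Obj 𝒳) (#x w) → Vec (Obj 𝒴) (#y w) → List Deco
  merge []       []       []       = []
  merge (Lb ∷ w) xs       ys       = bud ∷ merge w xs ys
  merge (Lx ∷ w) (x ∷ xs) ys       = inX x ∷ merge w xs ys
  merge (Ly ∷ w) xs       (y ∷ ys) = inY y ∷ merge w xs ys

  Unshuffled : Set
  Unshuffled = Σ (List Letter) (λ w → Vec (Obj 𝒳) (#x w) × Vec (Obj 𝒴) (#y w))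

  unshuffle : List Deco ↔ Unshuffled
  unshuffle = mk↔ₛ′ (λ d → map letter d , xs-of d , ys-of d) (λ (w , xs , ys) → merge w xs ys)
                    (λ (w , xs , ys) → split∘merge w xs ys) merge∘split
    where
    split∘merge : ∀ w xs ys →
                  _≡_ {A = Unshuffled} (map letter (merge w xs ys) , xs-of (merge w xs ys) , ys-of (merge w xs ys)) (w , xs , ys)
    split∘merge []       []       []       = refl
    split∘merge (Lb ∷ w) xs       ys       = cong (λ (w , xs , ys) → Lb ∷ w , xs , ys) (split∘merge w xs ys)
    split∘merge (Lx ∷ w) (x ∷ xs) ys       = cong (λ (w , xs , ys) → Lx ∷ w , x ∷ xs , ys) (split∘merge w xs ys)
    split∘merge (Ly ∷ w) xs       (y ∷ ys) = cong (λ (w , xs , ys) → Ly ∷ w , xs , y ∷ ys) (split∘merge w xs ys)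
    merge∘split : ∀ d → merge (map letter d) (xs-of d) (ys-of d) ≡ d
    merge∘split []          = refl
    merge∘split (bud ∷ d)   = cong (bud ∷_) (merge∘split d)
    merge∘split (inX x ∷ d) = cong (inX x ∷_) (merge∘split d)
    merge∘split (inY y ∷ d) = cong (inY y ∷_) (merge∘split d)

  sumBy-degᴰ : ∀ f g d → sumBy (degᴰ f g) d ≡ sumByᵥ f (xs-of d) + sumByᵥ g (ys-of d)
  sumBy-degᴰ f g []          = refl
  sumBy-degᴰ f g (bud ∷ d)   = sumBy-degᴰ f g d
  sumBy-degᴰ f g (inX x ∷ d) = trans (cong (f x +_) (sumBy-degᴰ f g d)) (sym (+-assoc (f x) _ _))
  sumBy-degᴰ f g (inY y ∷ d) = trans (cong (g y +_) (sumBy-degᴰ f g d)) (x∙yz≈y∙xz (g y) (sumByᵥ f (xs-of d)) _)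

  zdegᴰ udegᴰ : Deco → ℕ
  zdegᴰ = degᴰ (zdeg 𝒳) (zdeg 𝒴)
  udegᴰ = degᴰ (udeg 𝒳) (udeg 𝒴)

  -- x-decorations carry charge 1, y-decorations charge 0 and buds charge −1
  Charged : ℕ → List Letter → Set
  Charged δ w = #x w ≡ δ + #b w

  Decorated : ℕ → ℕ → ℕ → Set
  Decorated δ n k = Σ Shape (λ s → Σ (List Deco) (λ d →
    (length d ≡ slots s × Charged δ (map letter d)) × sumBy zdegᴰ d ≡ n × sumBy udegᴰ d ≡ k))

  Assembled : ℕ → ℕ → ℕ → Set
  Assembled δ n k = Σ ℕ λ a → Σ ℕ λ c →
    (ShapeWithSlots (a + (δ + a) + c) × Word a (δ + a) c) × Of (Tuples 𝒳 (δ + a) ⊗ Tuples 𝒴 c) n k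

  Decorated↔Assembled : ∀ δ n k → Decorated δ n k ↔ Assembled δ n k
  Decorated↔Assembled δ n k = Σ-congʳ (λ s → transport s ⨾ Σ-congˡ unshuffle) ⨾ regroup ⨾ fix-b
    where
    Cond : Shape → Unshuffled → Set
    Cond s (w , xs , ys) = (length w ≡ slots s × Charged δ w) ×
                           sumByᵥ (zdeg 𝒳) xs + sumByᵥ (zdeg 𝒴) ys ≡ n × sumByᵥ (udeg 𝒳) xs + sumByᵥ (udeg 𝒴) ys ≡ k
    transport : ∀ s → Σ (List Deco) (λ d → (length d ≡ slots s × Charged δ (map letter d)) × sumBy zdegᴰ d ≡ n × sumBy udegᴰ d ≡ k)
                    ↔ Σ (List Deco) (Cond s ∘ to unshuffle)
    transport s = Σ-cong-irrelevant (λ _ → constraints-irrelevant) (λ _ → constraints-irrelevant)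
      λ d → mk⇔ (λ ((len , ch) , zn , uk) → (trans (length-map letter d) len , ch) ,
                                            trans (sym (sumBy-degᴰ _ _ d)) zn , trans (sym (sumBy-degᴰ _ _ d)) uk)
                (λ ((len , ch) , zn , uk) → (trans (sym (length-map letter d)) len , ch) ,
                                            trans (sumBy-degᴰ _ _ d) zn , trans (sumBy-degᴰ _ _ d) uk)
    Indexed : Set
    Indexed = Σ ℕ λ a → Σ ℕ λ b → Σ ℕ λ c →
      b ≡ δ + a × (ShapeWithSlots (a + b + c) × Word a b c) × Of (Tuples 𝒳 b ⊗ Tuples 𝒴 c) n k
    regroup : Σ Shape (λ s → Σ Unshuffled (Cond s)) ↔ Indexed
    regroup = mk↔ₛ′
      (λ (s , (w , xs , ys) , (len , ch) , degs) →
         #b w , #x w , #y w , ch , ((s , trans (sym len) (length≡#b+#x+#y w)) , (w , refl , refl , refl)) , (xs , ys) , degs)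
      (λ { (a , b , c , ch , ((s , sl) , (w , refl , refl , refl)) , (xs , ys) , degs) →
         s , (w , xs , ys) , (trans (length≡#b+#x+#y w) (sym sl) , ch) , degs })
      (λ { (a , b , c , ch , ((s , sl) , (w , refl , refl , refl)) , (xs , ys) , degs) →
         cong₂ (λ ch sl → a , b , c , ch , ((s , sl) , (w , refl , refl , refl)) , (xs , ys) , degs)
               (≡-irrelevant _ _) (≡-irrelevant _ _) })
      (λ (s , u , _) → cong (λ c → s , u , c) (constraints-irrelevant _ _))
    fix-b : Indexed ↔ Assembled δ n k
    fix-b = mk↔ₛ′ (λ { (a , _ , c , refl , rest) → a , c , rest }) (λ (a , c , rest) → a , δ + a , c , refl , rest)
                  (λ _ → refl) (λ { (a , _ , c , refl , rest) → refl })

  module _ .{{_ : NonZero q}} {X Y : Series} {k : ℕ} (countX : Counts X 𝒳 k) (countY : Counts Y 𝒴 k)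
           (posX : Positive 𝒳 k) (posY : Positive 𝒴 k) (n : ℕ) where

    Term : ℕ → ℕ → ℕ → Set
    Term a b c = (ShapeWithSlots (a + b + c) × Word a b c) × Of (Tuples 𝒳 b ⊗ Tuples 𝒴 c) n k

    term↔ : ∀ a b c → Fin (tcoef (2 + q) (suc (a + b + c)) * multinom a b c * ((X ^ₛ b) *ₛ (Y ^ₛ c)) n k) ↔ Term a b c
    term↔ a b c =
      *↔× ⨾ ((*↔× ⨾ (tcoef↔ShapeWithSlots _ ×-↔ ↔-sym (Word↔multinom a b c)))
             ×-↔ ↔-sym (counts-⊗ (counts-tuples countX b) (counts-tuples countY c) n k ≤-refl))

    tuples-bounded : ∀ {b c} → Of (Tuples 𝒳 b ⊗ Tuples 𝒴 c) n k → b ≤ n × c ≤ n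
    tuples-bounded ((xs , ys) , zn , uk) =
      ≤-trans (length≤zdeg posX xs (≤-trans (m≤m+n _ _) (≤-reflexive uk))) (≤-trans (m≤m+n _ _) (≤-reflexive zn)) ,
      ≤-trans (length≤zdeg posY ys (≤-trans (m≤n+m _ _) (≤-reflexive uk))) (≤-trans (m≤n+m _ _) (≤-reflexive zn))

    Φ₂↔Assembled : Fin (Φ₂ (2 + q) X Y n k) ↔ Assembled 0 n k
    Φ₂↔Assembled =
      Fin-sumTo n _ ⨾ Σ≤-congʳ (λ a _ →
        Fin-sumTo n _ ⨾ Σ≤-congʳ (λ c _ → ≡⇒Fin↔ (index a c) ⨾ term↔ a a c)
        ⨾ Σ≤-unbound n (λ c t → proj₂ (tuples-bounded (proj₂ t))))
      ⨾ Σ≤-unbound n (λ a (c , t) → proj₁ (tuples-bounded (proj₂ t)))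
      where
      index : ∀ a c → tcoef (2 + q) (2 * a + c + 1) * multinom a a c * ((X ^ₛ a) *ₛ (Y ^ₛ c)) n k
                    ≡ tcoef (2 + q) (suc (a + a + c)) * multinom a a c * ((X ^ₛ a) *ₛ (Y ^ₛ c)) n k
      index a c = cong (λ m → tcoef (2 + q) m * multinom a a c * ((X ^ₛ a) *ₛ (Y ^ₛ c)) n k)
                       (trans (+-comm _ 1) (cong (λ m → suc (a + m + c)) (+-identityʳ a)))

    Φ₁↔Assembled : Fin (Φ₁ (2 + q) X Y n k) ↔ Assembled 1 n k
    Φ₁↔Assembled = Fin-sumTo n _ ⨾ Σ≤-congʳ by-bud-count ⨾ Σ≤-unbound n bound ⨾ shift
      where
      Shifted : ℕ → Set
      Shifted zero    = ⊥
      Shifted (suc a) = Σ ℕ (Term a (suc a))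
      index : ∀ a c → tcoef (2 + q) (2 * suc a + c) * multinom a (suc a) c * ((X ^ₛ suc a) *ₛ (Y ^ₛ c)) n k
                    ≡ tcoef (2 + q) (suc (a + suc a + c)) * multinom a (suc a) c * ((X ^ₛ suc a) *ₛ (Y ^ₛ c)) n k
      index a c = cong (λ m → tcoef (2 + q) (suc (a + suc m + c)) * multinom a (suc a) c * ((X ^ₛ suc a) *ₛ (Y ^ₛ c)) n k)
                       (+-identityʳ a)
      by-bud-count : ∀ i → i ≤ n → _ ↔ Shifted i
      by-bud-count zero    _ = Fin-sumTo n _ ⨾ ¬⇒↔Fin0 (λ { (_ , _ , ()) }) ⨾ 0↔⊥
      by-bud-count (suc a) _ =
        Fin-sumTo n _ ⨾ Σ≤-congʳ (λ c _ → ≡⇒Fin↔ (index a c) ⨾ term↔ a (suc a) c)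
        ⨾ Σ≤-unbound n (λ c t → proj₂ (tuples-bounded (proj₂ t)))
      bound : ∀ i → Shifted i → i ≤ n
      bound (suc a) (c , t) = proj₁ (tuples-bounded (proj₂ t))
      shift : Σ ℕ Shifted ↔ Assembled 1 n k
      shift = mk↔ₛ′ (λ { (suc a , t) → a , t }) (λ (a , t) → suc a , t) (λ _ → refl) (λ { (suc a , t) → refl })

-- Cutting a tree along the edges not in F: the root component and the subtrees hanging from it

module Trees (q : ℕ) where
  open Shapes q

  p : ℕ
  p = 2 + q

  data Slot : Set where
    leafSlot budSlot : Slot
    cut              : Node p → Slot

  mutual
    component : Node p → Filled Slot
    component (node cs) = filled (componentV cs)

    componentV : ∀ {r} → Vec (Child p) r → Vec (Position Slot) r
    componentV []                  = []
    componentV (leaf ∷ cs)         = slot leafSlot ∷ componentV cs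
    componentV (bud ∷ cs)          = slot budSlot ∷ componentV cs
    componentV (edge false t ∷ cs) = slot (cut t) ∷ componentV cs
    componentV (edge true t ∷ cs)  = subtree (component t) ∷ componentV cs

  mutual
    glue : Filled Slot → Node p
    glue (filled ps) = node (glueV ps)

    glueV : ∀ {r} → Vec (Position Slot) r → Vec (Child p) r
    glueV []                     = []
    glueV (slot leafSlot ∷ ps)   = leaf ∷ glueV ps
    glueV (slot budSlot ∷ ps)    = bud ∷ glueV ps
    glueV (slot (cut t) ∷ ps)    = edge false t ∷ glueV ps
    glueV (subtree f ∷ ps)       = edge true (glue f) ∷ glueV ps

  mutual
    component-glue : ∀ f → component (glue f) ≡ f
    component-glue (filled ps) = cong filled (componentV-glueV ps)

    componentV-glueV : ∀ {r} (ps : Vec (Position Slot) r) → componentV (glueV ps) ≡ ps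
    componentV-glueV []                   = refl
    componentV-glueV (slot leafSlot ∷ ps) = cong (_ ∷_) (componentV-glueV ps)
    componentV-glueV (slot budSlot ∷ ps)  = cong (_ ∷_) (componentV-glueV ps)
    componentV-glueV (slot (cut t) ∷ ps)  = cong (_ ∷_) (componentV-glueV ps)
    componentV-glueV (subtree f ∷ ps)     = cong₂ _∷_ (cong subtree (component-glue f)) (componentV-glueV ps)

  mutual
    glue-component : ∀ t → glue (component t) ≡ t
    glue-component (node cs) = cong node (glueV-componentV cs)

    glueV-componentV : ∀ {r} (cs : Vec (Child p) r) → glueV (componentV cs) ≡ cs
    glueV-componentV []                  = refl
    glueV-componentV (leaf ∷ cs)         = cong (_ ∷_) (glueV-componentV cs)
    glueV-componentV (bud ∷ cs)          = cong (_ ∷_) (glueV-componentV cs)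
    glueV-componentV (edge false t ∷ cs) = cong (_ ∷_) (glueV-componentV cs)
    glueV-componentV (edge true t ∷ cs)  = cong₂ _∷_ (cong (edge true) (glue-component t)) (glueV-componentV cs)

  Node↔Filled : Node p ↔ Filled Slot
  Node↔Filled = mk↔ₛ′ component glue component-glue glue-component

  slots-of : Node p → List Slot
  slots-of = contents ∘ component

  leavesˢ budsˢ cutsˢ rootLeavesˢ rootBudsˢ : Slot → ℕ
  leavesˢ leafSlot = 1
  leavesˢ budSlot  = 0
  leavesˢ (cut t)  = leaves t
  budsˢ leafSlot = 0
  budsˢ budSlot  = 1
  budsˢ (cut t)  = buds t
  cutsˢ leafSlot = 0
  cutsˢ budSlot  = 0
  cutsˢ (cut t)  = components t
  rootLeavesˢ leafSlot = 1
  rootLeavesˢ _        = 0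
  rootBudsˢ budSlot = 1
  rootBudsˢ _       = 0

  mutual
    leaves≡ : ∀ t → leaves t ≡ sumBy leavesˢ (slots-of t)
    leaves≡ (node cs) = leavesV≡ cs

    leavesV≡ : ∀ {r} (cs : Vec (Child p) r) → leavesV cs ≡ sumBy leavesˢ (contentsV (componentV cs))
    leavesV≡ []                  = refl
    leavesV≡ (leaf ∷ cs)         = cong suc (leavesV≡ cs)
    leavesV≡ (bud ∷ cs)          = leavesV≡ cs
    leavesV≡ (edge false t ∷ cs) = cong (leaves t +_) (leavesV≡ cs)
    leavesV≡ (edge true t ∷ cs)  = trans (cong₂ _+_ (leaves≡ t) (leavesV≡ cs)) (sym (sumBy-++ leavesˢ (slots-of t) _))

  mutual
    buds≡ : ∀ t → buds t ≡ sumBy budsˢ (slots-of t)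
    buds≡ (node cs) = budsV≡ cs

    budsV≡ : ∀ {r} (cs : Vec (Child p) r) → budsV cs ≡ sumBy budsˢ (contentsV (componentV cs))
    budsV≡ []                  = refl
    budsV≡ (leaf ∷ cs)         = budsV≡ cs
    budsV≡ (bud ∷ cs)          = cong suc (budsV≡ cs)
    budsV≡ (edge false t ∷ cs) = cong (buds t +_) (budsV≡ cs)
    budsV≡ (edge true t ∷ cs)  = trans (cong₂ _+_ (buds≡ t) (budsV≡ cs)) (sym (sumBy-++ budsˢ (slots-of t) _))

  mutual
    nonF≡ : ∀ t → nonF t ≡ sumBy cutsˢ (slots-of t)
    nonF≡ (node cs) = nonFV≡ cs

    nonFV≡ : ∀ {r} (cs : Vec (Child p) r) → nonFV cs ≡ sumBy cutsˢ (contentsV (componentV cs))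
    nonFV≡ []                  = refl
    nonFV≡ (leaf ∷ cs)         = nonFV≡ cs
    nonFV≡ (bud ∷ cs)          = nonFV≡ cs
    nonFV≡ (edge false t ∷ cs) = cong (λ m → suc (nonF t + m)) (nonFV≡ cs)
    nonFV≡ (edge true t ∷ cs)  = trans (cong₂ _+_ (nonF≡ t) (nonFV≡ cs)) (sym (sumBy-++ cutsˢ (slots-of t) _))

  mutual
    compLeaves≡ : ∀ t → compLeaves t ≡ sumBy rootLeavesˢ (slots-of t)
    compLeaves≡ (node cs) = compLeavesV≡ cs

    compLeavesV≡ : ∀ {r} (cs : Vec (Child p) r) → compLeavesV cs ≡ sumBy rootLeavesˢ (contentsV (componentV cs))
    compLeavesV≡ []                  = refl
    compLeavesV≡ (leaf ∷ cs)         = cong suc (compLeavesV≡ cs)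
    compLeavesV≡ (bud ∷ cs)          = compLeavesV≡ cs
    compLeavesV≡ (edge false t ∷ cs) = compLeavesV≡ cs
    compLeavesV≡ (edge true t ∷ cs)  =
      trans (cong₂ _+_ (compLeaves≡ t) (compLeavesV≡ cs)) (sym (sumBy-++ rootLeavesˢ (slots-of t) _))

  mutual
    compBuds≡ : ∀ t → compBuds t ≡ sumBy rootBudsˢ (slots-of t)
    compBuds≡ (node cs) = compBudsV≡ cs

    compBudsV≡ : ∀ {r} (cs : Vec (Child p) r) → compBudsV cs ≡ sumBy rootBudsˢ (contentsV (componentV cs))
    compBudsV≡ []                  = refl
    compBudsV≡ (leaf ∷ cs)         = compBudsV≡ cs
    compBudsV≡ (bud ∷ cs)          = cong suc (compBudsV≡ cs)
    compBudsV≡ (edge false t ∷ cs) = compBudsV≡ cs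
    compBudsV≡ (edge true t ∷ cs)  =
      trans (cong₂ _+_ (compBuds≡ t) (compBudsV≡ cs)) (sym (sumBy-++ rootBudsˢ (slots-of t) _))

  SlotOK : (Node p → Set) → Slot → Set
  SlotOK Q (cut t) = Q t × ForallNonF Q t
  SlotOK Q _       = ⊤

  mutual
    ForallNonF⇔All : ∀ Q t → ForallNonF Q t ⇔ All (SlotOK Q) (slots-of t)
    ForallNonF⇔All Q (node cs) = ForallNonFV⇔All Q cs

    ForallNonFV⇔All : ∀ Q {r} (cs : Vec (Child p) r) → ForallNonFV Q cs ⇔ All (SlotOK Q) (contentsV (componentV cs))
    ForallNonFV⇔All Q []                  = mk⇔ (λ _ → []) (λ _ → tt)
    ForallNonFV⇔All Q (leaf ∷ cs)         = mk⇔ (λ a → tt ∷ Equivalence.to (ForallNonFV⇔All Q cs) a)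
                                                (λ { (_ ∷ a) → Equivalence.from (ForallNonFV⇔All Q cs) a })
    ForallNonFV⇔All Q (bud ∷ cs)          = mk⇔ (λ a → tt ∷ Equivalence.to (ForallNonFV⇔All Q cs) a)
                                                (λ { (_ ∷ a) → Equivalence.from (ForallNonFV⇔All Q cs) a })
    ForallNonFV⇔All Q (edge false t ∷ cs) = mk⇔ (λ (ok , a) → ok ∷ Equivalence.to (ForallNonFV⇔All Q cs) a)
                                                (λ { (ok ∷ a) → ok , Equivalence.from (ForallNonFV⇔All Q cs) a })
    ForallNonFV⇔All Q (edge true t ∷ cs)  = mk⇔
      (λ (a , b) → All.++⁺ (Equivalence.to (ForallNonF⇔All Q t) a) (Equivalence.to (ForallNonFV⇔All Q cs) b))
      (λ a → let (a₁ , a₂) = All.++⁻ (slots-of t) a in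
             Equivalence.from (ForallNonF⇔All Q t) a₁ , Equivalence.from (ForallNonFV⇔All Q cs) a₂)

  mutual
    ForallNonF-irrelevant : ∀ {Q} → (∀ t → Irrelevant (Q t)) → ∀ t → Irrelevant (ForallNonF Q t)
    ForallNonF-irrelevant irr (node cs) = ForallNonFV-irrelevant irr cs

    ForallNonFV-irrelevant : ∀ {Q} → (∀ t → Irrelevant (Q t)) → ∀ {r} (cs : Vec (Child p) r) → Irrelevant (ForallNonFV Q cs)
    ForallNonFV-irrelevant irr []                  = ⊤-irrelevant
    ForallNonFV-irrelevant irr (leaf ∷ cs)         = ForallNonFV-irrelevant irr cs
    ForallNonFV-irrelevant irr (bud ∷ cs)          = ForallNonFV-irrelevant irr cs
    ForallNonFV-irrelevant irr (edge true t ∷ cs)  =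
      ×-irrelevant (ForallNonF-irrelevant irr t) (ForallNonFV-irrelevant irr cs)
    ForallNonFV-irrelevant irr (edge false t ∷ cs) =
      ×-irrelevant (×-irrelevant (irr t) (ForallNonF-irrelevant irr t)) (ForallNonFV-irrelevant irr cs)

  SlotOK-irrelevant : ∀ {Q} → (∀ t → Irrelevant (Q t)) → ∀ x → Irrelevant (SlotOK Q x)
  SlotOK-irrelevant irr leafSlot = ⊤-irrelevant
  SlotOK-irrelevant irr budSlot  = ⊤-irrelevant
  SlotOK-irrelevant irr (cut t)  = ×-irrelevant (irr t) (ForallNonF-irrelevant irr t)

  module Decompose (𝒳 𝒴 : Class) (Q : Node p → Set) (Q-irrelevant : ∀ t → Irrelevant (Q t))
                   (φ : Σ Slot (SlotOK Q) ↔ Decorations.Deco q 𝒳 𝒴)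
                   (zdeg-φ : ∀ x → Decorations.zdegᴰ q 𝒳 𝒴 (to φ x) ≡ leavesˢ (proj₁ x))
                   (udeg-φ : ∀ x → Decorations.udegᴰ q 𝒳 𝒴 (to φ x) ≡ cutsˢ (proj₁ x)) where
    open Decorations q 𝒳 𝒴

    GoodSlots : Set
    GoodSlots = Σ (List Slot) (All (SlotOK Q))

    decorate : GoodSlots → List Deco
    decorate ([] , [])           = []
    decorate (x ∷ l , ok ∷ oks) = to φ (x , ok) ∷ decorate (l , oks)

    undecorate : List Deco → GoodSlots
    undecorate []       = [] , []
    undecorate (d ∷ ds) = proj₁ (from φ d) ∷ proj₁ (undecorate ds) , proj₂ (from φ d) ∷ proj₂ (undecorate ds)

    GoodSlots↔Decos : GoodSlots ↔ List Deco
    GoodSlots↔Decos = mk↔ₛ′ decorate undecorate decorate∘undecorate undecorate∘decorate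
      where
      decorate∘undecorate : ∀ ds → decorate (undecorate ds) ≡ ds
      decorate∘undecorate []       = refl
      decorate∘undecorate (d ∷ ds) = cong₂ _∷_ (strictlyInverseˡ φ d) (decorate∘undecorate ds)
      cons-≡ : ∀ {x ok l oks} {u : Σ Slot (SlotOK Q)} {v : GoodSlots} → u ≡ (x , ok) → v ≡ (l , oks) →
               _≡_ {A = GoodSlots} (proj₁ u ∷ proj₁ v , proj₂ u ∷ proj₂ v) (x ∷ l , ok ∷ oks)
      cons-≡ refl refl = refl
      undecorate∘decorate : ∀ g → undecorate (decorate g) ≡ g
      undecorate∘decorate ([] , [])           = refl
      undecorate∘decorate (x ∷ l , ok ∷ oks) = cons-≡ (strictlyInverseʳ φ (x , ok)) (undecorate∘decorate (l , oks))

    length-decorate : ∀ g → length (decorate g) ≡ length (proj₁ g)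
    length-decorate ([] , [])           = refl
    length-decorate (x ∷ l , ok ∷ oks) = cong suc (length-decorate (l , oks))

    sumBy-decorate : ∀ (f : Deco → ℕ) (f′ : Slot → ℕ) → (∀ x → f (to φ x) ≡ f′ (proj₁ x)) →
                     ∀ g → sumBy f (decorate g) ≡ sumBy f′ (proj₁ g)
    sumBy-decorate f f′ eq ([] , [])           = refl
    sumBy-decorate f f′ eq (x ∷ l , ok ∷ oks) = cong₂ _+_ (eq (x , ok)) (sumBy-decorate f f′ eq (l , oks))

    Enriched : (Node p → Set) → ℕ → ℕ → Set
    Enriched Root n k = Σ (Node p) (λ t → (Root t × ForallNonF Q t) × leaves t ≡ n × components t ≡ suc k)

    module _ (δ : ℕ) (Root : Node p → Set) (Root-irrelevant : ∀ t → Irrelevant (Root t))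
             (Root⇔Charged : ∀ t ok → Root t ⇔ Charged δ (map letter (decorate (slots-of t , ok)))) where

      Enriched↔Decorated : ∀ n k → Enriched Root n k ↔ Decorated δ n k
      Enriched↔Decorated n k =
        Σ-cong-irrelevant
          (λ t → ×-irrelevant (×-irrelevant (Root-irrelevant t) (ForallNonF-irrelevant Q-irrelevant t)) degrees-irrelevant)
          (λ t → Cond′-irrelevant (slots-of t)) on-slots
        ⨾ Σ-congˡ Node↔Filled ⨾ Σ-congˡ Filled↔shape×contents ⨾ reassociate
        ⨾ Σ-congʳ (λ s → Σ-cong-irrelevant (λ _ → constraints-irrelevant) (λ _ → constraints-irrelevant) (on-decorations s)
                         ⨾ Σ-congˡ GoodSlots↔Decos)
        where
        Cond : GoodSlots → Set
        Cond g = Charged δ (map letter (decorate g)) × sumBy leavesˢ (proj₁ g) ≡ n × sumBy cutsˢ (proj₁ g) ≡ k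
        Cond′ : List Slot → Set
        Cond′ l = Σ (All (SlotOK Q) l) (λ ok → Cond (l , ok))
        Cond′-irrelevant : ∀ l → Irrelevant (Cond′ l)
        Cond′-irrelevant l (ok , c) (ok′ , c′) with All.irrelevant (SlotOK-irrelevant Q-irrelevant _) ok ok′
        ... | refl = cong (ok ,_) (×-irrelevant ≡-irrelevant degrees-irrelevant c c′)
        on-slots : ∀ t → ((Root t × ForallNonF Q t) × leaves t ≡ n × components t ≡ suc k) ⇔ Cond′ (slots-of t)
        on-slots t = mk⇔
          (λ ((r , f) , ln , ck) → let ok = Equivalence.to (ForallNonF⇔All Q t) f in
             ok , Equivalence.to (Root⇔Charged t ok) r , trans (sym (leaves≡ t)) ln , trans (sym (nonF≡ t)) (suc-injective ck))
          (λ (ok , ch , ln , ck) → (Equivalence.from (Root⇔Charged t ok) ch , Equivalence.from (ForallNonF⇔All Q t) ok) ,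
             trans (leaves≡ t) ln , cong suc (trans (nonF≡ t) ck))
        reassociate : Σ (Σ Shape (λ s → Σ (List Slot) (λ l → length l ≡ slots s))) (λ (_ , l , _) → Cond′ l)
                    ↔ Σ Shape (λ s → Σ GoodSlots (λ g → (length (proj₁ g) ≡ slots s × Charged δ (map letter (decorate g)))
                                                         × sumBy leavesˢ (proj₁ g) ≡ n × sumBy cutsˢ (proj₁ g) ≡ k))
        reassociate = mk↔ₛ′ (λ ((s , l , len) , ok , ch , degs) → s , (l , ok) , (len , ch) , degs)
                            (λ (s , (l , ok) , (len , ch) , degs) → (s , l , len) , ok , ch , degs)
                            (λ _ → refl) (λ _ → refl)
        on-decorations : ∀ s g → ((length (proj₁ g) ≡ slots s × Charged δ (map letter (decorate g)))
                                     × sumBy leavesˢ (proj₁ g) ≡ n × sumBy cutsˢ (proj₁ g) ≡ k)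
                                 ⇔ ((length (decorate g) ≡ slots s × Charged δ (map letter (decorate g)))
                                     × sumBy zdegᴰ (decorate g) ≡ n × sumBy udegᴰ (decorate g) ≡ k)
        on-decorations s g = mk⇔
          (λ ((len , ch) , ln , ck) → (trans (length-decorate g) len , ch) ,
             trans (sumBy-decorate zdegᴰ leavesˢ zdeg-φ g) ln , trans (sumBy-decorate udegᴰ cutsˢ udeg-φ g) ck)
          (λ ((len , ch) , ln , ck) → (trans (sym (length-decorate g)) len , ch) ,
             trans (sym (sumBy-decorate zdegᴰ leavesˢ zdeg-φ g)) ln , trans (sym (sumBy-decorate udegᴰ cutsˢ udeg-φ g)) ck)

charge-⇔ : ∀ a b c → (ℤ.+ a ℤ.- ℤ.+ b ≡ ℤ.+ c) ⇔ (a ≡ c + b)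
charge-⇔ a b c = mk⇔
  (λ e → ℤ.+-injective (trans (add-back (ℤ.+ a) (ℤ.+ b)) (cong (ℤ._+ ℤ.+ b) e)))
  (λ { refl → cancel (ℤ.+ c) (ℤ.+ b) })
  where
  add-back : ∀ x y → x ≡ (x ℤ.- y) ℤ.+ y
  add-back = ℤ-Solver.solve-∀
  cancel : ∀ x y → (x ℤ.+ y) ℤ.- y ≡ x
  cancel = ℤ-Solver.solve-∀

exchange-⇔ : ∀ {l b x d} δ → l + b ≡ x + d → (l ≡ δ + d) ⇔ (x ≡ δ + b)
exchange-⇔ {l} {b} {x} {d} δ balance = mk⇔
  (λ l≡ → +-cancelʳ-≡ d x (δ + b) (trans (sym balance) (trans (cong (_+ b) l≡) (swap δ d b))))
  (λ x≡ → +-cancelʳ-≡ b l (δ + d) (trans balance (trans (cong (_+ d) x≡) (swap δ b d))))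
  where
  swap : ∀ a b c → a + b + c ≡ a + c + b
  swap = solve-∀

module EnrichedTrees (q : ℕ) where
  open Shapes q
  open Trees q

  Charge01-irrelevant : ∀ (t : Node p) → Irrelevant (Charge01 t)
  Charge01-irrelevant t (inj₁ e) (inj₁ e′) = cong inj₁ (uip e e′)
  Charge01-irrelevant t (inj₂ e) (inj₂ e′) = cong inj₂ (uip e e′)
  Charge01-irrelevant t (inj₁ e) (inj₂ e′) with () ← trans (sym e) e′
  Charge01-irrelevant t (inj₂ e) (inj₁ e′) with () ← trans (sym e) e′

  𝓡 𝓢 𝓢̃ 𝓛 : Class
  𝓡 = mkClass (Σ (RTree p) IsEnrichedR) (leavesR ∘ proj₁) (componentsR ∘ proj₁)
  𝓢 = mkClass (Σ (Node p) IsEnrichedS) (leaves ∘ proj₁) (components ∘ proj₁)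
  𝓢̃ = mkClass (Σ (Node p) IsEnrichedS̃) (leaves ∘ proj₁) (components ∘ proj₁)
  𝓛 = mkClass ⊤ (λ _ → 1) (λ _ → 0)

  module CutRS where
    open Decorations q 𝓡 𝓢 public

    slot↔Deco : Σ Slot (SlotOK Charge01) ↔ Deco
    slot↔Deco = mk↔ₛ′ deco undeco deco∘undeco undeco∘deco
      where
      deco : Σ Slot (SlotOK Charge01) → Deco
      deco (leafSlot , tt)          = inX (rootLeaf , tt)
      deco (budSlot , tt)           = bud
      deco (cut t , inj₁ c₀ , ok)   = inY (t , c₀ , ok)
      deco (cut t , inj₂ c₁ , ok)   = inX (tree t , c₁ , ok)
      undeco : Deco → Σ Slot (SlotOK Charge01)
      undeco bud                      = budSlot , tt
      undeco (inX (rootLeaf , tt))    = leafSlot , tt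
      undeco (inX (tree t , c₁ , ok)) = cut t , inj₂ c₁ , ok
      undeco (inY (t , c₀ , ok))      = cut t , inj₁ c₀ , ok
      deco∘undeco : ∀ d → deco (undeco d) ≡ d
      deco∘undeco bud                 = refl
      deco∘undeco (inX (rootLeaf , _)) = refl
      deco∘undeco (inX (tree _ , _))   = refl
      deco∘undeco (inY _)              = refl
      undeco∘deco : ∀ x → undeco (deco x) ≡ x
      undeco∘deco (leafSlot , _)      = refl
      undeco∘deco (budSlot , _)       = refl
      undeco∘deco (cut _ , inj₁ _ , _) = refl
      undeco∘deco (cut _ , inj₂ _ , _) = refl

    zdeg-slot↔Deco : ∀ x → zdegᴰ (to slot↔Deco x) ≡ leavesˢ (proj₁ x)
    zdeg-slot↔Deco (leafSlot , _)      = refl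
    zdeg-slot↔Deco (budSlot , _)       = refl
    zdeg-slot↔Deco (cut _ , inj₁ _ , _) = refl
    zdeg-slot↔Deco (cut _ , inj₂ _ , _) = refl

    udeg-slot↔Deco : ∀ x → udegᴰ (to slot↔Deco x) ≡ cutsˢ (proj₁ x)
    udeg-slot↔Deco (leafSlot , _)      = refl
    udeg-slot↔Deco (budSlot , _)       = refl
    udeg-slot↔Deco (cut _ , inj₁ _ , _) = refl
    udeg-slot↔Deco (cut _ , inj₂ _ , _) = refl

    open Decompose 𝓡 𝓢 (Charge01 {p}) Charge01-irrelevant slot↔Deco zdeg-slot↔Deco udeg-slot↔Deco public

    -- leaves − buds of the slots is #x − #b: leaves and charge-1 subtrees are x-letters
    balance : ∀ g → sumBy leavesˢ (proj₁ g) + #b (map letter (decorate g))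
                  ≡ #x (map letter (decorate g)) + sumBy budsˢ (proj₁ g)
    balance ([] , [])                        = refl
    balance (leafSlot ∷ l , _ ∷ oks)         = cong suc (balance (l , oks))
    balance (budSlot ∷ l , _ ∷ oks)          = trans (+-suc _ _) (trans (cong suc (balance (l , oks))) (sym (+-suc _ _)))
    balance (cut t ∷ l , (inj₁ c₀ , _) ∷ oks) = begin
      leaves t + L + B              ≡⟨ +-assoc (leaves t) L B ⟩
      leaves t + (L + B)            ≡⟨ cong₂ _+_ (Equivalence.to (charge-⇔ (leaves t) (buds t) 0) c₀) (balance (l , oks)) ⟩
      buds t + (X + D)              ≡⟨ x∙yz≈y∙xz (buds t) X D ⟩
      X + (buds t + D)              ∎
      where
      open ≡-Reasoning
      L = sumBy leavesˢ l ; B = #b (map letter (decorate (l , oks)))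
      X = #x (map letter (decorate (l , oks))) ; D = sumBy budsˢ l
    balance (cut t ∷ l , (inj₂ c₁ , _) ∷ oks) = begin
      leaves t + L + B              ≡⟨ +-assoc (leaves t) L B ⟩
      leaves t + (L + B)            ≡⟨ cong₂ _+_ (Equivalence.to (charge-⇔ (leaves t) (buds t) 1) c₁) (balance (l , oks)) ⟩
      suc (buds t) + (X + D)        ≡⟨ cong suc (x∙yz≈y∙xz (buds t) X D) ⟩
      suc X + (buds t + D)          ∎
      where
      open ≡-Reasoning
      L = sumBy leavesˢ l ; B = #b (map letter (decorate (l , oks)))
      X = #x (map letter (decorate (l , oks))) ; D = sumBy budsˢ l

    charge⇔Charged : ∀ δ t ok → (charge t ≡ ℤ.+ δ) ⇔ Charged δ (map letter (decorate (slots-of t , ok)))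
    charge⇔Charged δ t ok =
      ⇔-trans (charge-⇔ (leaves t) (buds t) δ)
        (⇔-trans (mk⇔ (λ e → trans (sym (leaves≡ t)) (trans e (cong (δ +_) (buds≡ t))))
                      (λ e → trans (leaves≡ t) (trans e (cong (δ +_) (sym (buds≡ t))))))
                 (exchange-⇔ δ (balance (slots-of t , ok))))

  module CutS̃ where
    open Decorations q 𝓛 𝓢̃ public

    slot↔Deco : Σ Slot (SlotOK BalancedTop) ↔ Deco
    slot↔Deco = mk↔ₛ′ deco undeco deco∘undeco undeco∘deco
      where
      deco : Σ Slot (SlotOK BalancedTop) → Deco
      deco (leafSlot , tt) = inX tt
      deco (budSlot , tt)  = bud
      deco (cut t , ok)    = inY (t , ok)
      undeco : Deco → Σ Slot (SlotOK BalancedTop)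
      undeco bud            = budSlot , tt
      undeco (inX tt)       = leafSlot , tt
      undeco (inY (t , ok)) = cut t , ok
      deco∘undeco : ∀ d → deco (undeco d) ≡ d
      deco∘undeco bud     = refl
      deco∘undeco (inX _) = refl
      deco∘undeco (inY _) = refl
      undeco∘deco : ∀ x → undeco (deco x) ≡ x
      undeco∘deco (leafSlot , _) = refl
      undeco∘deco (budSlot , _)  = refl
      undeco∘deco (cut _ , _)    = refl

    zdeg-slot↔Deco : ∀ x → zdegᴰ (to slot↔Deco x) ≡ leavesˢ (proj₁ x)
    zdeg-slot↔Deco (leafSlot , _) = refl
    zdeg-slot↔Deco (budSlot , _)  = refl
    zdeg-slot↔Deco (cut _ , _)    = refl

    udeg-slot↔Deco : ∀ x → udegᴰ (to slot↔Deco x) ≡ cutsˢ (proj₁ x)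
    udeg-slot↔Deco (leafSlot , _) = refl
    udeg-slot↔Deco (budSlot , _)  = refl
    udeg-slot↔Deco (cut _ , _)    = refl

    open Decompose 𝓛 𝓢̃ (BalancedTop {p}) (λ _ → ≡-irrelevant) slot↔Deco zdeg-slot↔Deco udeg-slot↔Deco public

    rootLeaves≡#x : ∀ g → sumBy rootLeavesˢ (proj₁ g) ≡ #x (map letter (decorate g))
    rootLeaves≡#x ([] , [])              = refl
    rootLeaves≡#x (leafSlot ∷ l , _ ∷ oks) = cong suc (rootLeaves≡#x (l , oks))
    rootLeaves≡#x (budSlot ∷ l , _ ∷ oks)  = rootLeaves≡#x (l , oks)
    rootLeaves≡#x (cut _ ∷ l , _ ∷ oks)    = rootLeaves≡#x (l , oks)

    rootBuds≡#b : ∀ g → sumBy rootBudsˢ (proj₁ g) ≡ #b (map letter (decorate g))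
    rootBuds≡#b ([] , [])              = refl
    rootBuds≡#b (leafSlot ∷ l , _ ∷ oks) = rootBuds≡#b (l , oks)
    rootBuds≡#b (budSlot ∷ l , _ ∷ oks)  = cong suc (rootBuds≡#b (l , oks))
    rootBuds≡#b (cut _ ∷ l , _ ∷ oks)    = rootBuds≡#b (l , oks)

    balanced⇔Charged : ∀ t ok → BalancedTop t ⇔ Charged 0 (map letter (decorate (slots-of t , ok)))
    balanced⇔Charged t ok = mk⇔
      (λ e → trans (sym #x≡) (trans e #b≡))
      (λ e → trans #x≡ (trans e (sym #b≡)))
      where
      #x≡ = trans (compLeaves≡ t) (rootLeaves≡#x (slots-of t , ok))
      #b≡ = trans (compBuds≡ t) (rootBuds≡#b (slots-of t , ok))

-- One more component: counts in u-degree k + 1 from counts up to u-degree k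

module Counting (q : ℕ) .{{_ : NonZero q}} where
  open Trees q
  open EnrichedTrees q

  Φ₂-at-0 : ∀ X Y k → Φ₂ p X Y 0 k ≡ 0
  Φ₂-at-0 X Y k = cong (λ t → t * multinom 0 0 0 * ((X ^ₛ 0) *ₛ (Y ^ₛ 0)) 0 k) t₁≡0
    where
    t₁≡0 : tcoef p 1 ≡ 0
    t₁≡0 rewrite *-identityʳ q | +-comm q 2 = refl

  positive-𝓡 : ∀ k → Positive 𝓡 k
  positive-𝓡 k (rootLeaf , _)     _ = s≤s z≤n
  positive-𝓡 k (tree t , c₁ , _) _ =
    ≤-trans (s≤s z≤n) (≤-reflexive (sym (Equivalence.to (charge-⇔ (leaves t) (buds t) 1) c₁)))

  counts-𝓛 : ∀ k → Counts zₛ 𝓛 k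
  counts-𝓛 k 0             j       _ = ¬⇒↔Fin0 (λ ())
  counts-𝓛 k 1             0       _ = singleton↔Fin1 (tt , refl , refl) (λ { (tt , refl , refl) → refl })
  counts-𝓛 k 1             (suc j) _ = ¬⇒↔Fin0 (λ ())
  counts-𝓛 k (suc (suc n)) j       _ = ¬⇒↔Fin0 (λ ())

  R-base : ∀ n → Of 𝓡 n 0 ↔ Fin (zₛ n 0)
  R-base 0             = ¬⇒↔Fin0 (λ { ((rootLeaf , _) , () , _) ; ((tree _ , _) , _ , ()) })
  R-base 1             = singleton↔Fin1 ((rootLeaf , tt) , refl , refl)
                           (λ { ((rootLeaf , tt) , refl , refl) → refl ; ((tree _ , _) , _ , ()) })
  R-base (suc (suc n)) = ¬⇒↔Fin0 (λ { ((rootLeaf , _) , () , _) ; ((tree _ , _) , _ , ()) })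

  S-base : ∀ n → Of 𝓢 n 0 ↔ Fin 0
  S-base n = ¬⇒↔Fin0 (λ { (_ , _ , ()) })

  S̃-base : ∀ n → Of 𝓢̃ n 0 ↔ Fin 0
  S̃-base n = ¬⇒↔Fin0 (λ { (_ , _ , ()) })

  module _ {X Y : Series} {k : ℕ} (countX : Counts X 𝓡 k) (countY : Counts Y 𝓢 k) (posY : Positive 𝓢 k) (n : ℕ) where

    R-step : Of 𝓡 n (suc k) ↔ Fin (Φ₁ p X Y n k)
    R-step = drop-rootLeaf
           ⨾ CutRS.Enriched↔Decorated 1 _ (λ _ → uip) (CutRS.charge⇔Charged 1) n k
           ⨾ CutRS.Decorated↔Assembled 1 n k
           ⨾ ↔-sym (CutRS.Φ₁↔Assembled countX countY (positive-𝓡 k) posY n)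
      where
      drop-rootLeaf : Of 𝓡 n (suc k) ↔ CutRS.Enriched (λ t → charge t ≡ ℤ.+ 1) n k
      drop-rootLeaf = mk↔ₛ′ (λ { ((tree t , e) , l , c) → t , e , l , c ; ((rootLeaf , _) , _ , ()) })
                            (λ (t , e , l , c) → (tree t , e) , l , c)
                            (λ _ → refl)
                            (λ { ((tree t , e) , l , c) → refl ; ((rootLeaf , _) , _ , ()) })

    S-step : Of 𝓢 n (suc k) ↔ Fin (Φ₂ p X Y n k)
    S-step = Σ-assoc
           ⨾ CutRS.Enriched↔Decorated 0 _ (λ _ → uip) (CutRS.charge⇔Charged 0) n k
           ⨾ CutRS.Decorated↔Assembled 0 n k
           ⨾ ↔-sym (CutRS.Φ₂↔Assembled countX countY (positive-𝓡 k) posY n)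

  S̃-step : ∀ {Y k} → Counts Y 𝓢̃ k → Positive 𝓢̃ k → ∀ n → Of 𝓢̃ n (suc k) ↔ Fin (Φ₂ p zₛ Y n k)
  S̃-step {k = k} countY posY n =
    Σ-assoc
    ⨾ CutS̃.Enriched↔Decorated 0 _ (λ _ → ≡-irrelevant) CutS̃.balanced⇔Charged n k
    ⨾ CutS̃.Decorated↔Assembled 0 n k
    ⨾ ↔-sym (CutS̃.Φ₂↔Assembled (counts-𝓛 k) countY (λ _ _ → s≤s z≤n) posY n)

  positive-step : ∀ {C k} → ¬ Of C 0 (suc k) → Positive C k → Positive C (suc k)
  positive-step {C} {k} no-zero pos x u≤1+k with m≤n⇒m<n∨m≡n u≤1+k
  ... | inj₁ u<1+k = pos x (≤-pred u<1+k)
  ... | inj₂ u≡1+k with zdeg C x in z≡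
  ...   | zero  = ⊥-elim (no-zero (x , z≡ , u≡1+k))
  ...   | suc _ = s≤s z≤n

module Solutions (q : ℕ) .{{_ : NonZero q}} where
  open Trees q
  open EnrichedTrees q
  open Counting q

  z-above-0 : ∀ n k → zₛ n (suc k) ≡ 0
  z-above-0 0             k = refl
  z-above-0 1             k = refl
  z-above-0 (suc (suc n)) k = refl

  positive-mono : ∀ {C j k} → j ≤ k → Positive C k → Positive C j
  positive-mono j≤k pos x u≤j = pos x (≤-trans u≤j j≤k)

  no-zero-leaves : ∀ {C} → (∀ k → Positive C k) → ∀ k → ¬ Of C 0 k
  no-zero-leaves pos k (x , z≡0 , u≡k) = 1+n≰n (subst (1 ≤_) z≡0 (pos k x (≤-reflexive u≡k)))

  NextRS : Series → Series → Series → Series → Set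
  NextRS R S R′ S′ = (∀ n k → R′ n k ≡ (zₛ +ₛ uₛ (Φ₁ p R S)) n k) × (∀ n k → S′ n k ≡ uₛ (Φ₂ p R S) n k)

  CountsRS : Series → Series → ℕ → Set
  CountsRS R S k = Counts R 𝓡 k × Counts S 𝓢 k × Positive 𝓢 k

  countsRS-first : ∀ {R S R′ S′} → NextRS R S R′ S′ → CountsRS R′ S′ 0
  countsRS-first (eqR , eqS) =
    (λ { n 0 _ → R-base n ⨾ ≡⇒Fin↔ (sym (trans (eqR n 0) (+-identityʳ _))) }) ,
    (λ { n 0 _ → S-base n ⨾ ≡⇒Fin↔ (sym (eqS n 0)) }) ,
    (λ (t , _) ())

  countsRS-next : ∀ {R S R′ S′} k → NextRS R S R′ S′ → CountsRS R S k → CountsRS R′ S′ (suc k)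
  countsRS-next {R} {S} k (eqR , eqS) (countR , countS , posS) = countR′ , countS′ , posS′
    where
    countR′ : Counts _ 𝓡 (suc k)
    countR′ n 0       _         = R-base n ⨾ ≡⇒Fin↔ (sym (trans (eqR n 0) (+-identityʳ _)))
    countR′ n (suc j) (s≤s j≤k) =
      R-step (counts-mono j≤k countR) (counts-mono j≤k countS) (positive-mono j≤k posS) n
      ⨾ ≡⇒Fin↔ (sym (trans (eqR n (suc j)) (cong (_+ Φ₁ p R S n j) (z-above-0 n j))))
    countS′ : Counts _ 𝓢 (suc k)
    countS′ n 0       _         = S-base n ⨾ ≡⇒Fin↔ (sym (eqS n 0))
    countS′ n (suc j) (s≤s j≤k) =
      S-step (counts-mono j≤k countR) (counts-mono j≤k countS) (positive-mono j≤k posS) n ⨾ ≡⇒Fin↔ (sym (eqS n (suc j)))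
    posS′ : Positive 𝓢 (suc k)
    -- Φ₂ has no z⁰ term since t₁ = 0, so no S-tree without leaves has u-degree k + 1
    posS′ = positive-step (λ o → ¬Fin0 (subst Fin (Φ₂-at-0 R S k) (to (S-step countR countS posS 0) o))) posS

  RS-solution-counts : ∀ {R S} → SolvesRS p R S → ∀ k → CountsRS R S k
  RS-solution-counts (_ , _ , eqs) zero        = countsRS-first eqs
  RS-solution-counts sol@(_ , _ , eqs) (suc k) = countsRS-next k eqs (RS-solution-counts sol k)

  iterateRS : ℕ → Series × Series
  iterateRS zero    = (λ _ _ → 0) , (λ _ _ → 0)
  iterateRS (suc m) = let (R , S) = iterateRS m in zₛ +ₛ uₛ (Φ₁ p R S) , uₛ (Φ₂ p R S)

  counts-iterateRS : ∀ k → CountsRS (proj₁ (iterateRS (suc k))) (proj₂ (iterateRS (suc k))) k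
  counts-iterateRS zero    = countsRS-first ((λ _ _ → refl) , (λ _ _ → refl))
  counts-iterateRS (suc k) = countsRS-next k ((λ _ _ → refl) , (λ _ _ → refl)) (counts-iterateRS k)

  -- the coefficient of u^k is already exact in the (k+1)-st iterate
  R S : Series
  R n k = proj₁ (iterateRS (suc k)) n k
  S n k = proj₂ (iterateRS (suc k)) n k

  counts-R : ∀ k → Counts R 𝓡 k
  counts-R = counts-diagonal (λ k → proj₁ (iterateRS (suc k))) (λ k → proj₁ (counts-iterateRS k))

  counts-S : ∀ k → Counts S 𝓢 k
  counts-S = counts-diagonal (λ k → proj₂ (iterateRS (suc k))) (λ k → proj₁ (proj₂ (counts-iterateRS k)))

  positive-𝓢 : ∀ k → Positive 𝓢 k
  positive-𝓢 k = proj₂ (proj₂ (counts-iterateRS k))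

  zero-constant : ∀ {C f} → (∀ k → Counts f C k) → (∀ k → Positive C k) → ZeroConst f
  zero-constant count pos k = Fin-injective (↔-sym (count k 0 k ≤-refl) ⨾ ¬⇒↔Fin0 (no-zero-leaves pos k))

  RS-counting-solves : ∀ {R S} → (∀ k → Counts R 𝓡 k) → (∀ k → Counts S 𝓢 k) → (∀ k → Positive 𝓢 k) → NextRS R S R S
  RS-counting-solves {R} {S} countR countS posS = eqR , eqS
    where
    eqR : ∀ n k → R n k ≡ (zₛ +ₛ uₛ (Φ₁ p R S)) n k
    eqR n 0       = trans (Fin-injective (↔-sym (countR 0 n 0 ≤-refl) ⨾ R-base n)) (sym (+-identityʳ _))
    eqR n (suc k) = trans (Fin-injective (↔-sym (countR (suc k) n (suc k) ≤-refl) ⨾ R-step (countR k) (countS k) (posS k) n))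
                          (sym (cong (_+ Φ₁ p R S n k) (z-above-0 n k)))
    eqS : ∀ n k → S n k ≡ uₛ (Φ₂ p R S) n k
    eqS n 0       = Fin-injective (↔-sym (countS 0 n 0 ≤-refl) ⨾ S-base n)
    eqS n (suc k) = Fin-injective (↔-sym (countS (suc k) n (suc k) ≤-refl) ⨾ S-step (countR k) (countS k) (posS k) n)

  R-S-solve : SolvesRS p R S
  R-S-solve = zero-constant counts-R positive-𝓡 , zero-constant counts-S positive-𝓢 ,
              RS-counting-solves counts-R counts-S positive-𝓢

  R-S-unique : ∀ R′ S′ → SolvesRS p R′ S′ → (∀ n k → R′ n k ≡ R n k) × (∀ n k → S′ n k ≡ S n k)
  R-S-unique R′ S′ sol =
    (λ n k → counted-equal (proj₁ (RS-solution-counts sol k)) (counts-R k) n) ,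
    (λ n k → counted-equal (proj₁ (proj₂ (RS-solution-counts sol k))) (counts-S k) n)

  NextS̃ : Series → Series → Set
  NextS̃ T T′ = ∀ n k → T′ n k ≡ uₛ (Φ₂ p zₛ T) n k

  CountsS̃ : Series → ℕ → Set
  CountsS̃ T k = Counts T 𝓢̃ k × Positive 𝓢̃ k

  countsS̃-first : ∀ {T T′} → NextS̃ T T′ → CountsS̃ T′ 0
  countsS̃-first eq = (λ { n 0 _ → S̃-base n ⨾ ≡⇒Fin↔ (sym (eq n 0)) }) , (λ (t , _) ())

  countsS̃-next : ∀ {T T′} k → NextS̃ T T′ → CountsS̃ T k → CountsS̃ T′ (suc k)
  countsS̃-next {T} k eq (countT , posT) = countT′ , posT′
    where
    countT′ : Counts _ 𝓢̃ (suc k)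
    countT′ n 0       _         = S̃-base n ⨾ ≡⇒Fin↔ (sym (eq n 0))
    countT′ n (suc j) (s≤s j≤k) = S̃-step (counts-mono j≤k countT) (positive-mono j≤k posT) n ⨾ ≡⇒Fin↔ (sym (eq n (suc j)))
    posT′ : Positive 𝓢̃ (suc k)
    posT′ = positive-step (λ o → ¬Fin0 (subst Fin (Φ₂-at-0 zₛ T k) (to (S̃-step countT posT 0) o))) posT

  S̃-solution-counts : ∀ {T} → SolvesS̃ p T → ∀ k → CountsS̃ T k
  S̃-solution-counts (_ , eq) zero        = countsS̃-first eq
  S̃-solution-counts sol@(_ , eq) (suc k) = countsS̃-next k eq (S̃-solution-counts sol k)

  iterateS̃ : ℕ → Series
  iterateS̃ zero    = λ _ _ → 0
  iterateS̃ (suc m) = uₛ (Φ₂ p zₛ (iterateS̃ m))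

  counts-iterateS̃ : ∀ k → CountsS̃ (iterateS̃ (suc k)) k
  counts-iterateS̃ zero    = countsS̃-first (λ _ _ → refl)
  counts-iterateS̃ (suc k) = countsS̃-next k (λ _ _ → refl) (counts-iterateS̃ k)

  S̃ : Series
  S̃ n k = iterateS̃ (suc k) n k

  counts-S̃ : ∀ k → Counts S̃ 𝓢̃ k
  counts-S̃ = counts-diagonal (λ k → iterateS̃ (suc k)) (λ k → proj₁ (counts-iterateS̃ k))

  positive-𝓢̃ : ∀ k → Positive 𝓢̃ k
  positive-𝓢̃ k = proj₂ (counts-iterateS̃ k)

  S̃-solve : SolvesS̃ p S̃
  S̃-solve = zero-constant counts-S̃ positive-𝓢̃ , eq
    where
    eq : ∀ n k → S̃ n k ≡ uₛ (Φ₂ p zₛ S̃) n k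
    eq n 0       = Fin-injective (↔-sym (counts-S̃ 0 n 0 ≤-refl) ⨾ S̃-base n)
    eq n (suc k) = Fin-injective (↔-sym (counts-S̃ (suc k) n (suc k) ≤-refl) ⨾ S̃-step (counts-S̃ k) (positive-𝓢̃ k) n)

  S̃-unique : ∀ T → SolvesS̃ p T → ∀ n k → T n k ≡ S̃ n k
  S̃-unique T sol n k = counted-equal (proj₁ (S̃-solution-counts sol k)) (counts-S̃ k) n

proposition5p3 : (p : ℕ) → 3 ≤ p →
    Σ Series (λ R → Σ Series (λ S → Σ Series (λ S̃ →
    (SolvesRS p R S
    × (∀ R′ S′ → SolvesRS p R′ S′ → (∀ n k → R′ n k ≡ R n k) × (∀ n k → S′ n k ≡ S n k)))
    × (SolvesS̃ p S̃ × (∀ T → SolvesS̃ p T → ∀ n k → T n k ≡ S̃ n k))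
    × (∀ n k → EnrR p n k ↔ Fin (R n k))
    × (∀ n k → EnrS p n k ↔ Fin (S n k))
    × (∀ n k → EnrS̃ p n k ↔ Fin (S̃ n k)))))
proposition5p3 (suc (suc (suc q))) (s≤s (s≤s (s≤s _))) =
  R , S , S̃ , (R-S-solve , R-S-unique) , (S̃-solve , S̃-unique) ,
  (λ n k → ↔-sym Σ-assoc ⨾ counts-R k n k ≤-refl) ,
  (λ n k → ↔-sym Σ-assoc ⨾ counts-S k n k ≤-refl) ,
  (λ n k → ↔-sym Σ-assoc ⨾ counts-S̃ k n k ≤-refl)
  where open Solutions (suc q)
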